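{- Let $k$ be a field, $W\colon\mathbb{Z}^2\to\mathbb{Z}$ a perfect matching, $\mathbf{K}\in\mathbb{Z}^2$ and $\mathbf{L}=\mathbf{K}+(1,1)$. For any $\mathbf{d}\in\mathbb{Z}^2$ there is an isomorphism $$\operatorname{Hom}(\mathcal{M}_{W,\mathbf{d}},\underline{k}_{/B_1,B_2})\to\operatorname{Hom}(\underline{k},\mathcal{M}_{W^*_{\mathbf{L}},\mathbf{K}-\mathbf{d}})$$ induced as follows: under the decompositions $\mathcal{M}_{W,\mathbf{d}}\simeq\bigoplus_{W(\mathbf{a})=1}\mathcal{I}_{\mathbf{d}\ge\mathbf{a}}$ and $\mathcal{M}_{W^*_{\mathbf{L}},\mathbf{K}-\mathbf{d}}\simeq\bigoplus_{W(\mathbf{a}')=1}\mathcal{I}_{\mathbf{K}-\mathbf{d}\ge\mathbf{L}-\mathbf{a}'}$ into indicator diagrams, both sides become direct sums, indexed by $\{\mathbf{a}: W(\mathbf{a})=1,\ \mathbf{a}\ge\mathbf{d}+(1,1)\}$, of copies of $\operatorname{Hom}(\underline{k}_{/B_1,B_2},\underline{k}_{/B_1,B_2})$ and of $\operatorname{Hom}(\underline{k},\underline{k})$ respectively, and the isomorphism is, summand by summand, the isomorphism $\operatorname{Hom}(\underline{k}_{/B_1,B_2},\underline{k}_{/B_1,B_2})\to\operatorname{Hom}(\underline{k},\underline{k})$ (both one-dimensional) taking the identity morphism to the identity morphism. Moreover, this gives an isomorphism $H^1(\mathcal{M}_{W,\mathbf{d}})^*\to\operatorname{Hom}(\underline{k},\mathcal{M}_{W^*_{\mathbf{L}},\mathbf{K}-\mathbf{d}})$,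 and isomorphisms $H^i(\mathcal{M}_{W,\mathbf{d}})^*\to H^{1-i}(\mathcal{M}_{W^*_{\mathbf{L}},\mathbf{K}-\mathbf{d}})$ for $i=0,1$.
   Context: A perfect matching is $W\colon\mathbb{Z}^2\to\mathbb{Z}$, zero when $d_1+d_2$ is sufficiently small or large, with a bijection $\pi$ of $\mathbb{Z}$ such that $W(a,b)=1$ if $b=\pi(a)$ and $0$ otherwise. $W^*_{\mathbf{L}}(\mathbf{d})=W(\mathbf{L}-\mathbf{d})$ (again a perfect matching). Componentwise partial order on $\mathbb{Z}^2$. A $k$-diagram $\mathcal{F}$ consists of $k$-vector spaces $\mathcal{F}(B_1),\mathcal{F}(B_2),\mathcal{F}(B_3),\mathcal{F}(A_1),\mathcal{F}(A_2)$ and linear maps $\rho_{1,1}\colon\mathcal{F}(B_1)\to\mathcal{F}(A_1)$, $\rho_{2,2}\colon\mathcal{F}(B_2)\to\mathcal{F}(A_2)$, $\rho_{3,1},\rho_{3,2}$ from $\mathcal{F}(B_3)$ to $\mathcal{F}(A_1),\mathcal{F}(A_2)$; differential $\partial(b_1,b_2,b_3)=(\rho_{1,1}b_1-\rho_{3,1}b_3,\rho_{2,2}b_2-\rho_{3,2}b_3)$; $H^0=\ker\partial$, $H^1=\operatorname{coker}\partial$. Morphisms are valuewise linear maps commuting with the $\rho$'s; $\operatorname{Hom}$ is the $k$-vector space of morphisms; direct sums valuewise. $\underline{k}$ has all five values $k$ and all maps the identity; $\underline{k}_{/B_1,B_2}$ is the same with values $0$ at $B_1,B_2$. For $\mathbf{a},\mathbf{d}\in\mathbb{Z}^2$,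 the indicator diagram $\mathcal{I}_{\mathbf{d}\ge\mathbf{a}}$ has values $k$ at $B_3,A_1,A_2$, value $k$ at $B_j$ if $a_j\le d_j$ and $0$ otherwise ($j=1,2$), all maps $k\to k$ the identity. For a perfect matching $W$ with bijection $\pi$, $\mathcal{M}_{W,\mathbf{d}}$ has $B_i$-value $k^{\oplus\mathbb{Z}_{\le d_i}}$, $A_i$-value $k^{\oplus\mathbb{Z}}$ ($i=1,2$; $k^{\oplus S}$ has basis $\{\mathbf{e}_s\}$), $\rho_{i,i}$ inclusions, $B_3$-value with basis indexed by $\{(a,\pi(a))\}$, and $\rho_{3,1},\rho_{3,2}$ sending that basis vector to $\mathbf{e}_a,\mathbf{e}_{\pi(a)}$. -}

module Defs where

open import Level using (Level; _⊔_; Lift; lift; lower) renaming (suc to lsuc)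
open import Algebra.Bundles using (CommutativeRing)
open import Data.Integer as ℤ using (ℤ; +_; _-_; ∣_∣; 1ℤ) renaming (_+_ to _+ℤ_; _≤_ to _≤ℤ_)
open import Data.Integer.Properties as ℤP using ()
open import Data.Integer.Tactic.RingSolver using (solve-∀)
import Data.Nat as ℕ
import Data.Nat.Properties as ℕP
open import Data.Product using (Σ; ∃; _×_; _,_; proj₁; proj₂)
open import Data.Unit.Polymorphic using (⊤; tt)
open import Data.Empty using (⊥-elim)
open import Data.List using (List; []; _∷_; map)
open import Data.List.Membership.Propositional using (_∈_; _∉_)
open import Data.List.Membership.Propositional.Properties using (∈-map⁺)
open import Data.List.Relation.Unary.Any using (here)
open import Relation.Nullary using (¬_; Dec; yes; no; contradiction)
open import Relation.Binary.PropositionalEquality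
  using (_≡_; _≢_; refl; sym; trans; cong; subst)

sub-sub : ∀ i j → i - (i - j) ≡ j
sub-sub = solve-∀

private
  shift-lem : ∀ k d → (k +ℤ 1ℤ) - (d +ℤ 1ℤ) ≡ k - d
  shift-lem = solve-∀

  sum-lem : ∀ a b l m → a +ℤ b ≡ (l +ℤ m) - ((l - a) +ℤ (m - b))
  sum-lem = solve-∀

bound-lem : ∀ K d a → d +ℤ 1ℤ ≤ℤ a → (K +ℤ 1ℤ) - a ≤ℤ K - d
bound-lem K d a h =
  subst ((K +ℤ 1ℤ) - a ≤ℤ_) (shift-lem K d)
    (ℤP.+-monoʳ-≤ (K +ℤ 1ℤ) (ℤP.neg-mono-≤ h))

record Bij : Set where
  field
    π π⁻¹ : ℤ → ℤ
    π∘π⁻¹ : ∀ b → π (π⁻¹ b) ≡ b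
    π⁻¹∘π : ∀ a → π⁻¹ (π a) ≡ a

record PerfectMatching : Set where
  field
    W   : ℤ × ℤ → ℤ
    bij : Bij
  open Bij bij public
  field
    W-on    : ∀ a b → b ≡ π a → W (a , b) ≡ + 1
    W-off   : ∀ a b → b ≢ π a → W (a , b) ≡ + 0
    bounded : ∃ λ (N : ℕ.ℕ) → ∀ a b → N ℕ.< ∣ a +ℤ b ∣ → W (a , b) ≡ + 0

_+²_ : ℤ × ℤ → ℤ × ℤ → ℤ × ℤ
(a , b) +² (c , d) = (a +ℤ c , b +ℤ d)

_-²_ : ℤ × ℤ → ℤ × ℤ → ℤ × ℤ
(a , b) -² (c , d) = (a - c , b - d)

one² : ℤ × ℤ
one² = (1ℤ , 1ℤ)

dualBij : ℤ × ℤ → Bij → Bij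
dualBij (L₁ , L₂) β = record
  { π     = λ x → L₂ - π (L₁ - x)
  ; π⁻¹   = λ y → L₁ - π⁻¹ (L₂ - y)
  ; π∘π⁻¹ = λ y → trans (cong (λ t → L₂ - π t) (sub-sub L₁ _))
                   (trans (cong (L₂ -_) (π∘π⁻¹ (L₂ - y))) (sub-sub L₂ y))
  ; π⁻¹∘π = λ x → trans (cong (λ t → L₁ - π⁻¹ t) (sub-sub L₂ _))
                   (trans (cong (L₁ -_) (π⁻¹∘π (L₁ - x))) (sub-sub L₁ x))
  }
  where open Bij β

dualPM : ℤ × ℤ → PerfectMatching → PerfectMatching
dualPM L@(L₁ , L₂) P = record
  { W       = λ x → W (L -² x)
  ; bij     = dualBij L bij
  ; W-on    = λ a b e → W-on (L₁ - a) (L₂ - b)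
                (trans (cong (L₂ -_) e) (sub-sub L₂ _))
  ; W-off   = λ a b ne → W-off (L₁ - a) (L₂ - b)
                (λ e → ne (trans (sym (sub-sub L₂ b)) (cong (L₂ -_) e)))
  ; bounded = N ℕ.+ ∣ L₁ +ℤ L₂ ∣ , λ a b lt →
      hN (L₁ - a) (L₂ - b)
        (ℕP.+-cancelˡ-< ∣ L₁ +ℤ L₂ ∣ N _
          (ℕP.<-≤-trans (subst (ℕ._< ∣ a +ℤ b ∣) (ℕP.+-comm N _) lt)
            (subst (λ t → ∣ t ∣ ℕ.≤ ∣ L₁ +ℤ L₂ ∣ ℕ.+ ∣ (L₁ - a) +ℤ (L₂ - b) ∣)
                   (sym (sum-lem a b L₁ L₂))
                   (ℤP.∣i-j∣≤∣i∣+∣j∣ (L₁ +ℤ L₂) ((L₁ - a) +ℤ (L₂ - b))))))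
  }
  where
  open PerfectMatching P
  N  = proj₁ bounded
  hN = proj₂ bounded

dual-π-inv : ∀ (β : Bij) {x b} → Bij.π⁻¹ β b ≡ x → b ≡ Bij.π β x
dual-π-inv β {x} {b} e = trans (sym (Bij.π∘π⁻¹ β b)) (cong (Bij.π β) e)

dual-π-inv′ : ∀ (β : Bij) {x b} → b ≡ Bij.π β x → Bij.π⁻¹ β b ≡ x
dual-π-inv′ β {x} {b} e = trans (cong (Bij.π⁻¹ β) e) (Bij.π⁻¹∘π β x)

record Field c ℓ : Set (lsuc (c ⊔ ℓ)) where
  field
    commutativeRing : CommutativeRing c ℓ
  open CommutativeRing commutativeRing public
  field
    0≉1     : ¬ (0# ≈ 1#)
    inverse : ∀ x → ¬ (x ≈ 0#) → ∃ λ y → (x * y) ≈ 1#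

module Over {c ℓ} (F : Field c ℓ) where
  open Field F using (0#; _≈_; _+_; _*_; +-identityʳ; zeroʳ) renaming (Carrier to K; refl to ≈-refl; sym to ≈-sym; trans to ≈-trans; reflexive to ≈-reflexive)

  L₀ : Level
  L₀ = c ⊔ ℓ

  -- A k-vector space, presented by its equality, and the graphs of its
  -- addition (Sum x y z : "z = x + y") and scalar multiplication
  -- (Scale λ x z : "z = λ x").
  record Space : Set (lsuc L₀) where
    field
      Carrier : Set L₀
      _≋_     : Carrier → Carrier → Set L₀
      Sum     : Carrier → Carrier → Carrier → Set L₀
      Scale   : K → Carrier → Carrier → Set L₀

  open Space public using (Carrier)

  record LinMap (V U : Space) : Set L₀ where
    private
      module V = Space V
      module U = Space U
    field
      fun         : V.Carrier → U.Carrier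
      resp        : ∀ {x y} → x V.≋ y → fun x U.≋ fun y
      additive    : ∀ {x y z} → V.Sum x y z → U.Sum (fun x) (fun y) (fun z)
      homogeneous : ∀ {s x z} → V.Scale s x z → U.Scale s (fun x) (fun z)

  open LinMap public using (fun)

  record LinIso (V U : Space) : Set L₀ where
    private
      module V = Space V
      module U = Space U
    field
      to      : LinMap V U
      from    : LinMap U V
      to∘from : ∀ y → fun to (fun from y) U.≋ y
      from∘to : ∀ x → fun from (fun to x) V.≋ x

  kSpace : Space
  kSpace = record
    { Carrier = Lift ℓ K
    ; _≋_     = λ x y → Lift c (lower x ≈ lower y)
    ; Sum     = λ x y z → Lift c (lower z ≈ (lower x + lower y))
    ; Scale   = λ s x z → Lift c (lower z ≈ (s * lower x))
    }

  zeroSpace : Space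
  zeroSpace = record
    { Carrier = ⊤ ; _≋_ = λ _ _ → ⊤ ; Sum = λ _ _ _ → ⊤ ; Scale = λ _ _ _ → ⊤ }

  -- k^{⊕S} for S = {n ∈ ℤ | P n}: finitely supported coefficient functions
  record FinSupp (P : ℤ → Set) : Set L₀ where
    field
      coeff   : ℤ → K
      support : List ℤ
      vanish  : ∀ n → n ∉ support → coeff n ≈ 0#
      outside : ∀ n → ¬ P n → coeff n ≈ 0#

  open FinSupp public

  kSum : (P : ℤ → Set) → Space
  kSum P = record
    { Carrier = FinSupp P
    ; _≋_     = λ f g → Lift c (∀ n → coeff f n ≈ coeff g n)
    ; Sum     = λ f g h → Lift c (∀ n → coeff h n ≈ (coeff f n + coeff g n))
    ; Scale   = λ s f h → Lift c (∀ n → coeff h n ≈ (s * coeff f n))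
    }

  kℤ : Space
  kℤ = kSum (λ _ → ⊤)

  kℤ≤ : ℤ → Space
  kℤ≤ d = kSum (λ n → n ≤ℤ d)

  idMap : ∀ {V} → LinMap V V
  idMap = record { fun = λ x → x ; resp = λ e → e ; additive = λ s → s ; homogeneous = λ s → s }

  incl : ∀ d → LinMap (kℤ≤ d) kℤ
  incl d = record
    { fun = λ f → record { coeff = coeff f ; support = support f ; vanish = vanish f
                         ; outside = λ n ¬t → ⊥-elim (¬t tt) }
    ; resp = λ e → e ; additive = λ s → s ; homogeneous = λ s → s }

  -- e_a ↦ e_{π a}, i.e. (reindex f)(b) = f (π⁻¹ b)
  reindex : Bij → LinMap kℤ kℤ
  reindex β = record
    { fun = λ f → record
        { coeff   = λ b → coeff f (π⁻¹ b)
        ; support = map π (support f)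
        ; vanish  = λ b b∉ → vanish f (π⁻¹ b)
                      (λ m → b∉ (subst (_∈ map π (support f)) (π∘π⁻¹ b) (∈-map⁺ π m)))
        ; outside = λ n ¬t → ⊥-elim (¬t tt) }
    ; resp = λ (lift e) → lift (λ b → e (π⁻¹ b))
    ; additive = λ (lift e) → lift (λ b → e (π⁻¹ b))
    ; homogeneous = λ (lift e) → lift (λ b → e (π⁻¹ b)) }
    where open Bij β

  record Diagram : Set (lsuc L₀) where
    field
      B₁ B₂ B₃ A₁ A₂ : Space
      ρ₁₁ : LinMap B₁ A₁
      ρ₂₂ : LinMap B₂ A₂
      ρ₃₁ : LinMap B₃ A₁
      ρ₃₂ : LinMap B₃ A₂

  record Mor (𝓕 𝓖 : Diagram) : Set L₀ where
    private
      module 𝓕 = Diagram 𝓕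
      module 𝓖 = Diagram 𝓖
    field
      φB₁ : LinMap 𝓕.B₁ 𝓖.B₁
      φB₂ : LinMap 𝓕.B₂ 𝓖.B₂
      φB₃ : LinMap 𝓕.B₃ 𝓖.B₃
      φA₁ : LinMap 𝓕.A₁ 𝓖.A₁
      φA₂ : LinMap 𝓕.A₂ 𝓖.A₂
      sq₁₁ : ∀ x → Space._≋_ 𝓖.A₁ (fun 𝓖.ρ₁₁ (fun φB₁ x)) (fun φA₁ (fun 𝓕.ρ₁₁ x))
      sq₂₂ : ∀ x → Space._≋_ 𝓖.A₂ (fun 𝓖.ρ₂₂ (fun φB₂ x)) (fun φA₂ (fun 𝓕.ρ₂₂ x))
      sq₃₁ : ∀ x → Space._≋_ 𝓖.A₁ (fun 𝓖.ρ₃₁ (fun φB₃ x)) (fun φA₁ (fun 𝓕.ρ₃₁ x))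
      sq₃₂ : ∀ x → Space._≋_ 𝓖.A₂ (fun 𝓖.ρ₃₂ (fun φB₃ x)) (fun φA₂ (fun 𝓕.ρ₃₂ x))

  open Mor public

  module _ (𝓕 𝓖 : Diagram) where
    private
      module 𝓖 = Diagram 𝓖
    Pw₂ : (∀ V → Carrier V → Carrier V → Set L₀) → Mor 𝓕 𝓖 → Mor 𝓕 𝓖 → Set L₀
    Pw₂ R f g =
        (∀ x → R 𝓖.B₁ (fun (φB₁ f) x) (fun (φB₁ g) x))
      × (∀ x → R 𝓖.B₂ (fun (φB₂ f) x) (fun (φB₂ g) x))
      × (∀ x → R 𝓖.B₃ (fun (φB₃ f) x) (fun (φB₃ g) x))
      × (∀ x → R 𝓖.A₁ (fun (φA₁ f) x) (fun (φA₁ g) x))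
      × (∀ x → R 𝓖.A₂ (fun (φA₂ f) x) (fun (φA₂ g) x))

    Pw₃ : (∀ V → Carrier V → Carrier V → Carrier V → Set L₀) → Mor 𝓕 𝓖 → Mor 𝓕 𝓖 → Mor 𝓕 𝓖 → Set L₀
    Pw₃ R f g h =
        (∀ x → R 𝓖.B₁ (fun (φB₁ f) x) (fun (φB₁ g) x) (fun (φB₁ h) x))
      × (∀ x → R 𝓖.B₂ (fun (φB₂ f) x) (fun (φB₂ g) x) (fun (φB₂ h) x))
      × (∀ x → R 𝓖.B₃ (fun (φB₃ f) x) (fun (φB₃ g) x) (fun (φB₃ h) x))
      × (∀ x → R 𝓖.A₁ (fun (φA₁ f) x) (fun (φA₁ g) x) (fun (φA₁ h) x))
      × (∀ x → R 𝓖.A₂ (fun (φA₂ f) x) (fun (φA₂ g) x) (fun (φA₂ h) x))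

    HomSpace : Space
    HomSpace = record
      { Carrier = Mor 𝓕 𝓖
      ; _≋_     = Pw₂ Space._≋_
      ; Sum     = Pw₃ Space.Sum
      ; Scale   = λ s → Pw₂ (λ V → Space.Scale V s)
      }

  -- H⁰(𝓕) = ker ∂, where ∂(b₁,b₂,b₃) = (ρ₁₁b₁ - ρ₃₁b₃, ρ₂₂b₂ - ρ₃₂b₃);
  -- ∂ b = 0 means ρ₁₁b₁ = ρ₃₁b₃ and ρ₂₂b₂ = ρ₃₂b₃.
  module _ (𝓕 : Diagram) where
    private
      module 𝓕 = Diagram 𝓕
      module B₁ = Space 𝓕.B₁
      module B₂ = Space 𝓕.B₂
      module B₃ = Space 𝓕.B₃
      module A₁ = Space 𝓕.A₁
      module A₂ = Space 𝓕.A₂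

    record Ker∂ : Set L₀ where
      field
        b₁ : B₁.Carrier
        b₂ : B₂.Carrier
        b₃ : B₃.Carrier
        ∂b≡0₁ : fun 𝓕.ρ₁₁ b₁ A₁.≋ fun 𝓕.ρ₃₁ b₃
        ∂b≡0₂ : fun 𝓕.ρ₂₂ b₂ A₂.≋ fun 𝓕.ρ₃₂ b₃

    open Ker∂

    H⁰ : Space
    H⁰ = record
      { Carrier = Ker∂
      ; _≋_     = λ x y → (b₁ x B₁.≋ b₁ y) × (b₂ x B₂.≋ b₂ y) × (b₃ x B₃.≋ b₃ y)
      ; Sum     = λ x y z → B₁.Sum (b₁ x) (b₁ y) (b₁ z) × B₂.Sum (b₂ x) (b₂ y) (b₂ z)
                            × B₃.Sum (b₃ x) (b₃ y) (b₃ z)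
      ; Scale   = λ s x z → B₁.Scale s (b₁ x) (b₁ z) × B₂.Scale s (b₂ x) (b₂ z)
                            × B₃.Scale s (b₃ x) (b₃ z)
      }

    -- x - y ∈ im ∂, i.e. for some b: x₁ - y₁ = ρ₁₁b₁ - ρ₃₁b₃ and
    -- x₂ - y₂ = ρ₂₂b₂ - ρ₃₂b₃, i.e. x₁ + ρ₃₁b₃ = y₁ + ρ₁₁b₁ and
    -- x₂ + ρ₃₂b₃ = y₂ + ρ₂₂b₂.
    CohEq : A₁.Carrier × A₂.Carrier → A₁.Carrier × A₂.Carrier → Set L₀
    CohEq (x₁ , x₂) (y₁ , y₂) =
      Σ B₁.Carrier λ c₁ → Σ B₂.Carrier λ c₂ → Σ B₃.Carrier λ c₃ →
      Σ A₁.Carrier λ u₁ → Σ A₂.Carrier λ u₂ →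
        A₁.Sum x₁ (fun 𝓕.ρ₃₁ c₃) u₁ × A₁.Sum y₁ (fun 𝓕.ρ₁₁ c₁) u₁
      × A₂.Sum x₂ (fun 𝓕.ρ₃₂ c₃) u₂ × A₂.Sum y₂ (fun 𝓕.ρ₂₂ c₂) u₂

    H¹ : Space
    H¹ = record
      { Carrier = A₁.Carrier × A₂.Carrier
      ; _≋_     = CohEq
      ; Sum     = λ { (x₁ , x₂) (y₁ , y₂) z → Σ A₁.Carrier λ w₁ → Σ A₂.Carrier λ w₂ →
                        A₁.Sum x₁ y₁ w₁ × A₂.Sum x₂ y₂ w₂ × CohEq (w₁ , w₂) z }
      ; Scale   = λ { s (x₁ , x₂) z → Σ A₁.Carrier λ w₁ → Σ A₂.Carrier λ w₂ →
                        A₁.Scale s x₁ w₁ × A₂.Scale s x₂ w₂ × CohEq (w₁ , w₂) z }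
      }

  Dual : Space → Space
  Dual V = record
    { Carrier = LinMap V kSpace
    ; _≋_     = λ f g → ∀ x → Space._≋_ kSpace (fun f x) (fun g x)
    ; Sum     = λ f g h → ∀ x → Space.Sum kSpace (fun f x) (fun g x) (fun h x)
    ; Scale   = λ s f h → ∀ x → Space.Scale kSpace s (fun f x) (fun h x)
    }

  kDiag : Diagram
  kDiag = record
    { B₁ = kSpace ; B₂ = kSpace ; B₃ = kSpace ; A₁ = kSpace ; A₂ = kSpace
    ; ρ₁₁ = idMap ; ρ₂₂ = idMap ; ρ₃₁ = idMap ; ρ₃₂ = idMap }

  zeroMap : LinMap zeroSpace kSpace
  zeroMap = record
    { fun = λ _ → lift 0#
    ; resp = λ _ → lift ≈-refl
    ; additive = λ _ → lift (≈-sym (+-identityʳ 0#))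
    ; homogeneous = λ {s} _ → lift (≈-sym (zeroʳ s)) }

  kDiag/B₁B₂ : Diagram
  kDiag/B₁B₂ = record
    { B₁ = zeroSpace ; B₂ = zeroSpace ; B₃ = kSpace ; A₁ = kSpace ; A₂ = kSpace
    ; ρ₁₁ = zeroMap ; ρ₂₂ = zeroMap ; ρ₃₁ = idMap ; ρ₃₂ = idMap }

  -- the diagram M_{W,d}.  The B₃-value has basis indexed by the pairs
  -- (a , π a), which we index by their first coordinate a ∈ ℤ; then
  -- ρ₃₁ e_a = e_a and ρ₃₂ e_a = e_{π a}.

  M : PerfectMatching → ℤ × ℤ → Diagram
  M P (d₁ , d₂) = record
    { B₁ = kℤ≤ d₁ ; B₂ = kℤ≤ d₂ ; B₃ = kℤ ; A₁ = kℤ ; A₂ = kℤ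
    ; ρ₁₁ = incl d₁ ; ρ₂₂ = incl d₂ ; ρ₃₁ = idMap
    ; ρ₃₂ = reindex (PerfectMatching.bij P) }

  evalAt : ∀ {P} → ℤ → LinMap (kSum P) kSpace
  evalAt n = record
    { fun = λ f → lift (coeff f n)
    ; resp = λ (lift e) → lift (e n)
    ; additive = λ (lift e) → lift (e n)
    ; homogeneous = λ (lift e) → lift (e n) }

  toZero : ∀ {V} → LinMap V zeroSpace
  toZero = record { fun = λ _ → tt ; resp = λ _ → tt ; additive = λ _ → tt ; homogeneous = λ _ → tt }

  private
    not≤ : ∀ d a → d +ℤ 1ℤ ≤ℤ a → ¬ (a ≤ℤ d)
    not≤ d a h = ℤP.<⇒≱ (ℤP.suc[i]≤j⇒i<j (subst (_≤ℤ a) (ℤP.+-comm d 1ℤ) h))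

  -- For a = (a₁ , π a₁) with W(a) = 1 and a ≥ d + (1,1): the morphism
  -- M_{W,d} → k_{/B₁,B₂} which is the identity of k_{/B₁,B₂} ≅ 𝓘_{d ≥ a}
  -- on the summand indexed by a and zero on all other summands.
  ε : (P : PerfectMatching) (d : ℤ × ℤ) (a₁ : ℤ) →
      proj₁ d +ℤ 1ℤ ≤ℤ a₁ → proj₂ d +ℤ 1ℤ ≤ℤ PerfectMatching.π P a₁ →
      Mor (M P d) kDiag/B₁B₂
  ε P (d₁ , d₂) a₁ h₁ h₂ = record
    { φB₁ = toZero ; φB₂ = toZero
    ; φB₃ = evalAt a₁ ; φA₁ = evalAt a₁ ; φA₂ = evalAt (π a₁)
    ; sq₁₁ = λ x → lift (≈-sym (outside x a₁ (not≤ d₁ a₁ h₁)))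
    ; sq₂₂ = λ x → lift (≈-sym (outside x (π a₁) (not≤ d₂ (π a₁) h₂)))
    ; sq₃₁ = λ x → lift ≈-refl
    ; sq₃₂ = λ x → lift (≈-reflexive (cong (coeff x) (sym (π⁻¹∘π a₁)))) }
    where open PerfectMatching P

  sel : ∀ {i n : ℤ} → Dec (n ≡ i) → K → K
  sel (yes _) x = x
  sel (no _)  _ = 0#

  single : (P : ℤ → Set) (i : ℤ) → P i → K → FinSupp P
  single P i p x = record
    { coeff   = λ n → sel (n ℤ.≟ i) x
    ; support = i ∷ []
    ; vanish  = λ n n∉ → vanish′ n (λ e → n∉ (here e))
    ; outside = λ n ¬p → vanish′ n (λ e → ¬p (subst P (sym e) p)) }
    where
    vanish′ : ∀ n → n ≢ i → sel (n ℤ.≟ i) x ≈ 0#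
    vanish′ n ne with n ℤ.≟ i
    ... | yes e = ⊥-elim (ne e)
    ... | no _  = ≈-refl

  singleMap : (P : ℤ → Set) (i : ℤ) → P i → LinMap kSpace (kSum P)
  singleMap P i p = record
    { fun = λ x → single P i p (lower x)
    ; resp = λ (lift e) → lift (λ n → r n e)
    ; additive = λ (lift e) → lift (λ n → a n e)
    ; homogeneous = λ {s} (lift e) → lift (λ n → h n s e) }
    where
    r : ∀ n {x y} → x ≈ y → sel (n ℤ.≟ i) x ≈ sel (n ℤ.≟ i) y
    r n e with n ℤ.≟ i
    ... | yes _ = e
    ... | no _  = ≈-refl
    a : ∀ n {x y z} → z ≈ (x + y) → sel (n ℤ.≟ i) z ≈ (sel (n ℤ.≟ i) x + sel (n ℤ.≟ i) y)
    a n e with n ℤ.≟ i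
    ... | yes _ = e
    ... | no _  = ≈-sym (+-identityʳ 0#)
    h : ∀ n s {x z} → z ≈ (s * x) → sel (n ℤ.≟ i) z ≈ (s * sel (n ℤ.≟ i) x)
    h n s e with n ℤ.≟ i
    ... | yes _ = e
    ... | no _  = ≈-sym (zeroʳ s)

  -- For a = (a₁ , π a₁) with W(a) = 1 and a ≥ d + (1,1), with L = K + (1,1):
  -- the morphism k → M_{W*_L, K - d} which is the identity k ≅ 𝓘_{K-d ≥ L-a}
  -- onto the summand indexed by L - a (that is, by a′ = a with W(a′) = 1).
  -- The B₃-basis of M_{W*_L,·} is indexed by first coordinates, and the first
  -- coordinate of L - a is x₀ = L₁ - a₁; its second coordinate is π*(x₀).
  η : (P : PerfectMatching) (Kv d : ℤ × ℤ) (a₁ : ℤ) →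
      proj₁ d +ℤ 1ℤ ≤ℤ a₁ → proj₂ d +ℤ 1ℤ ≤ℤ PerfectMatching.π P a₁ →
      Mor kDiag (M (dualPM (Kv +² one²) P) (Kv -² d))
  η P (K₁ , K₂) (d₁ , d₂) a₁ h₁ h₂ = record
    { φB₁ = singleMap (_≤ℤ K₁ - d₁) x₀ (bound-lem K₁ d₁ a₁ h₁)
    ; φB₂ = singleMap (_≤ℤ K₂ - d₂) y₀
              (subst (_≤ℤ K₂ - d₂)
                (cong (λ t → (K₂ +ℤ 1ℤ) - π t) (sym (sub-sub (K₁ +ℤ 1ℤ) a₁)))
                (bound-lem K₂ d₂ (π a₁) h₂))
    ; φB₃ = singleMap (λ _ → ⊤) x₀ tt
    ; φA₁ = singleMap (λ _ → ⊤) x₀ tt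
    ; φA₂ = singleMap (λ _ → ⊤) y₀ tt
    ; sq₁₁ = λ _ → lift (λ _ → ≈-refl)
    ; sq₂₂ = λ _ → lift (λ _ → ≈-refl)
    ; sq₃₁ = λ _ → lift (λ _ → ≈-refl)
    ; sq₃₂ = λ x → lift (λ b → sq (lower x) b) }
    where
    open PerfectMatching P
    β = dualBij ((K₁ +ℤ 1ℤ) , (K₂ +ℤ 1ℤ)) bij
    x₀ = (K₁ +ℤ 1ℤ) - a₁
    y₀ = Bij.π β x₀
    sq : ∀ x b → sel (Bij.π⁻¹ β b ℤ.≟ x₀) x ≈ sel (b ℤ.≟ y₀) x
    sq x b with Bij.π⁻¹ β b ℤ.≟ x₀ | b ℤ.≟ y₀
    ... | yes _ | yes _ = ≈-refl
    ... | no _  | no _  = ≈-refl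
    ... | yes e | no ne = ⊥-elim (ne (dual-π-inv β e))
    ... | no ne | yes e = ⊥-elim (ne (dual-π-inv′ β e))

-- Everything is computed from the matched pairs (a , π a).  Since |a + π a| is bounded, only
-- finitely many of them lie in S = {a ≥ d + (1,1)} or in T = {a ≤ d}.  A morphism
-- M_{W,d} → k_{/B₁,B₂} is a weight on S, and so is a morphism k → M_{W*_L,K-d} after the
-- reflection a ↦ L - a, which exchanges a ≥ d + (1,1) with L - a ≤ K - d; matching the weights
-- gives the first isomorphism and sends ε_a to η_a.  For every M_{Q,p}, H¹(M)* ≅ Hom(M, k_{/B₁,B₂})
-- (a functional on coker ∂ is a pair of functionals on A₁, A₂ killing im ∂) and
-- Hom(k, M) ≅ H⁰(M) (evaluation at 1), which yields the second and fourth isomorphisms.  For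
-- the third, cocycles of M_{W,d} are spanned by the basis cocycles indexed by T, and every class
-- of H¹(M_{W*_L,K-d}) is represented by a vector on A₁ supported on the reflection of T.

module Submission where

open import Defs
open import Level using (Level; lift; lower)
import Data.Integer as ℤ
open import Data.Integer using (ℤ; 1ℤ; _+_; _≤_; +_; -_; _-_; ∣_∣; 0ℤ; _≟_; _≤?_)
import Data.Integer.Properties as ℤP
open import Data.Integer.Tactic.RingSolver using (solve-∀)
import Data.Nat as ℕ
import Data.Nat.Properties as ℕP
open import Data.Product using (Σ; _×_; _,_; proj₁; proj₂)
open import Data.Unit.Polymorphic using (tt)
open import Data.Empty using (⊥-elim)
open import Data.List using (List; []; _∷_; map; _++_)
open import Data.List.Membership.Propositional using (_∈_; _∉_)
open import Data.List.Membership.Propositional.Properties using (∈-map⁺; ∈-++⁺ˡ; ∈-++⁺ʳ)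
open import Data.List.Membership.DecPropositional _≟_ using (_∈?_)
open import Data.List.Relation.Unary.Any using (here; there)
open import Relation.Nullary using (¬_; Dec; yes; no)
open import Relation.Nullary.Decidable using (decidable-stable)
open import Relation.Binary.PropositionalEquality
  using (_≡_; _≢_; refl; sym; trans; cong; subst)

+1≤⇒≰ : ∀ {a d} → d + 1ℤ ≤ a → ¬ (a ≤ d)
+1≤⇒≰ {a} {d} h = ℤP.<⇒≱ (ℤP.suc[i]≤j⇒i<j (subst (_≤ a) (ℤP.+-comm d 1ℤ) h))

≰⇒+1≤ : ∀ {a d} → ¬ (a ≤ d) → d + 1ℤ ≤ a
≰⇒+1≤ {a} {d} h = subst (_≤ a) (ℤP.+-comm 1ℤ d) (ℤP.i<j⇒suc[i]≤j (ℤP.≰⇒> h))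

≤-from-gap : ∀ {i j} g → g ≡ j - i → 0ℤ ≤ g → i ≤ j
≤-from-gap g e p = ℤP.0≤i-j⇒j≤i (subst (0ℤ ≤_) e p)

bound-lem⁻¹ : ∀ K d a → (K + 1ℤ) - a ≤ K - d → d + 1ℤ ≤ a
bound-lem⁻¹ K d a h = ≤-from-gap _ (gap K d a) (ℤP.i≤j⇒0≤j-i h)
  where
  gap : ∀ K d a → (K - d) - ((K + 1ℤ) - a) ≡ a - (d + 1ℤ)
  gap = solve-∀

≤⇒reflected-≰ : ∀ K d a → a ≤ d → ¬ ((K + 1ℤ) - a ≤ K - d)
≤⇒reflected-≰ K d a a≤d h = +1≤⇒≰ (bound-lem⁻¹ K d a h) a≤d

reflected-≰⇒≤ : ∀ K d a → ¬ ((K + 1ℤ) - a ≤ K - d) → a ≤ d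
reflected-≰⇒≤ K d a h = decidable-stable (a ≤? d) (λ a≰d → h (bound-lem K d a (≰⇒+1≤ a≰d)))

∣i∣≤n⇒i≤n : ∀ i n → ∣ i ∣ ℕ.≤ n → i ≤ + n
∣i∣≤n⇒i≤n (+ _)      n p = ℤ.+≤+ p
∣i∣≤n⇒i≤n ℤ.-[1+ _ ] n p = ℤ.-≤+

∣i∣≤n⇒-n≤i : ∀ i n → ∣ i ∣ ℕ.≤ n → - (+ n) ≤ i
∣i∣≤n⇒-n≤i i n p = subst (- (+ n) ≤_) (ℤP.neg-involutive i)
  (ℤP.neg-mono-≤ (∣i∣≤n⇒i≤n (- i) n (subst (ℕ._≤ n) (sym (ℤP.∣-i∣≡∣i∣ i)) p)))

interval : ℤ → ℕ.ℕ → List ℤ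
interval lo ℕ.zero    = []
interval lo (ℕ.suc m) = lo ∷ interval (lo + 1ℤ) m

∈-interval⇒≥ : ∀ m {lo a} → a ∈ interval lo m → lo ≤ a
∈-interval⇒≥ (ℕ.suc m)      (here refl) = ℤP.≤-refl
∈-interval⇒≥ (ℕ.suc m) {lo} (there a∈) =
  ℤP.≤-trans (ℤP.i≤i+j lo 1ℤ) (∈-interval⇒≥ m a∈)

∉-interval-suc : ∀ m lo → lo ∉ interval (lo + 1ℤ) m
∉-interval-suc m lo lo∈ = +1≤⇒≰ (∈-interval⇒≥ m lo∈) ℤP.≤-refl

∈-interval : ∀ m {lo a} → lo ≤ a → a - lo ≤ + m → a ∈ interval lo (ℕ.suc m)
∈-interval m {lo} {a} lo≤a a-lo≤m with a ≟ lo
... | yes refl = here refl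
∈-interval ℕ.zero {lo} {a} lo≤a a-lo≤0 | no a≢lo =
  ⊥-elim (a≢lo (ℤP.≤-antisym (≤-from-gap _ (gap a lo) (ℤP.i≤j⇒0≤j-i a-lo≤0)) lo≤a))
  where
  gap : ∀ a lo → + 0 - (a - lo) ≡ lo - a
  gap = solve-∀
∈-interval (ℕ.suc m) {lo} {a} lo≤a a-lo≤m | no a≢lo =
  there (∈-interval m (≰⇒+1≤ (λ a≤lo → a≢lo (ℤP.≤-antisym a≤lo lo≤a)))
                      (≤-from-gap _ (gap a lo (+ m)) (ℤP.i≤j⇒0≤j-i a-lo≤m)))
  where
  gap : ∀ a lo m → (1ℤ + m) - (a - lo) ≡ m - (a - (lo + 1ℤ))
  gap = solve-∀

closedInterval : ℤ → ℤ → List ℤ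
closedInterval lo hi = interval lo (ℕ.suc ∣ hi - lo ∣)

∈-closedInterval : ∀ {lo hi a} → lo ≤ a → a ≤ hi → a ∈ closedInterval lo hi
∈-closedInterval {lo} {hi} lo≤a a≤hi = ∈-interval ∣ hi - lo ∣ lo≤a
  (ℤP.≤-trans (ℤP.+-monoˡ-≤ (- lo) a≤hi) (∣i∣≤n⇒i≤n (hi - lo) _ ℕP.≤-refl))

module Linear {c ℓ : Level} (F : Field c ℓ) where
  open Over F
  open Field F
    using (0#; 1#; _≈_; setoid; +-cong; *-cong; zeroʳ; zeroˡ; *-identityʳ; *-identityˡ;
           +-identityʳ; +-identityˡ; -‿cong; -‿inverseʳ; +-comm)
    renaming (Carrier to K; _+_ to _+ₖ_; _*_ to _*ₖ_; -_ to -ₖ_; _-_ to _-ₖ_;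
              refl to ≈refl; sym to ≈sym; trans to ≈trans; reflexive to ≈reflexive)
  open import Algebra.Solver.Ring.NaturalCoefficients.Default (Field.commutativeSemiring F)
    using (solve; _:=_; _:+_; _:*_)
  open import Algebra.Properties.Group (Field.+-group F)
    using (ε⁻¹≈ε; ⁻¹-involutive; inverseˡ-unique; //-rightDividesˡ)
  open import Algebra.Properties.AbelianGroup (Field.+-abelianGroup F) using (⁻¹-∙-comm)
  open import Algebra.Properties.Ring (Field.ring F) using (-‿distribʳ-*)
  open import Relation.Binary.Reasoning.Setoid setoid

  *≈0ʳ : ∀ {s x} → x ≈ 0# → s *ₖ x ≈ 0#
  *≈0ʳ {s} e = ≈trans (*-cong ≈refl e) (zeroʳ s)

  *≈0ˡ : ∀ {s x} → s ≈ 0# → s *ₖ x ≈ 0#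
  *≈0ˡ {x = x} e = ≈trans (*-cong e ≈refl) (zeroˡ x)

  0*x≈0*y : ∀ {s x y} → s ≈ 0# → s *ₖ x ≈ s *ₖ y
  0*x≈0*y s≈0 = ≈trans (*≈0ˡ s≈0) (≈sym (*≈0ˡ s≈0))

  0+0≈0 : 0# +ₖ 0# ≈ 0#
  0+0≈0 = +-identityʳ 0#

  −-cong : ∀ {a a′ b b′} → a ≈ a′ → b ≈ b′ → a -ₖ b ≈ a′ -ₖ b′
  −-cong p q = +-cong p (-‿cong q)

  -‿+-distrib : ∀ a b → -ₖ (a +ₖ b) ≈ (-ₖ a) +ₖ (-ₖ b)
  -‿+-distrib a b = ≈sym (⁻¹-∙-comm a b)

  x-0≈x : ∀ a → a -ₖ 0# ≈ a
  x-0≈x a = ≈trans (+-cong ≈refl ε⁻¹≈ε) (+-identityʳ a)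

  x--y≈x+y : ∀ a b → a -ₖ (-ₖ b) ≈ a +ₖ b
  x--y≈x+y a b = +-cong ≈refl (⁻¹-involutive b)

  -[0-x]≈x : ∀ b → -ₖ (0# -ₖ b) ≈ b
  -[0-x]≈x b = ≈trans (-‿cong (+-identityˡ _)) (⁻¹-involutive b)

  [x-y]+y≈x : ∀ a b → (a -ₖ b) +ₖ b ≈ a
  [x-y]+y≈x a b = //-rightDividesˡ b a

  x+[y-x]≈y : ∀ a b → a +ₖ (b -ₖ a) ≈ b
  x+[y-x]≈y a b = ≈trans (+-comm a (b -ₖ a)) ([x-y]+y≈x b a)

  [a+b]-[c+d]≈[a-c]+[b-d] : ∀ a b c d → (a +ₖ b) -ₖ (c +ₖ d) ≈ (a -ₖ c) +ₖ (b -ₖ d)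
  [a+b]-[c+d]≈[a-c]+[b-d] a b c d =
    ≈trans (+-cong ≈refl (-‿+-distrib c d)) (interchange a b (-ₖ c) (-ₖ d))
    where
    interchange : ∀ a b c d → (a +ₖ b) +ₖ (c +ₖ d) ≈ (a +ₖ c) +ₖ (b +ₖ d)
    interchange = solve 4 (λ a b c d → ((a :+ b) :+ (c :+ d)) := ((a :+ c) :+ (b :+ d))) ≈refl

  [x+t]-[y+t]≈x-y : ∀ x y t → (x +ₖ t) -ₖ (y +ₖ t) ≈ x -ₖ y
  [x+t]-[y+t]≈x-y x y t = begin
    (x +ₖ t) -ₖ (y +ₖ t)       ≈⟨ [a+b]-[c+d]≈[a-c]+[b-d] x t y t ⟩
    (x -ₖ y) +ₖ (t -ₖ t)       ≈⟨ +-cong ≈refl (-‿inverseʳ t) ⟩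
    (x -ₖ y) +ₖ 0#             ≈⟨ +-identityʳ _ ⟩
    x -ₖ y                     ∎

  *-distribˡ-− : ∀ s a b → s *ₖ a -ₖ s *ₖ b ≈ s *ₖ (a -ₖ b)
  *-distribˡ-− s a b = ≈trans (+-cong ≈refl (-‿distribʳ-* s b)) (distrib s a (-ₖ b))
    where
    distrib : ∀ s a b → s *ₖ a +ₖ s *ₖ b ≈ s *ₖ (a +ₖ b)
    distrib = solve 3 (λ s a b → (s :* a :+ s :* b) := (s :* (a :+ b))) ≈refl

  *-preserves-Sum : ∀ c {x y z} → z ≈ x +ₖ y → c *ₖ z ≈ c *ₖ x +ₖ c *ₖ y
  *-preserves-Sum c {x} {y} h = ≈trans (*-cong ≈refl h) (distrib c x y)
    where
    distrib : ∀ c x y → c *ₖ (x +ₖ y) ≈ c *ₖ x +ₖ c *ₖ y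
    distrib = solve 3 (λ c x y → (c :* (x :+ y)) := (c :* x :+ c :* y)) ≈refl

  *-preserves-Scale : ∀ c {s x z} → z ≈ s *ₖ x → c *ₖ z ≈ s *ₖ (c *ₖ x)
  *-preserves-Scale c {s} {x} h = ≈trans (*-cong ≈refl h) (swap c s x)
    where
    swap : ∀ c s x → c *ₖ (s *ₖ x) ≈ s *ₖ (c *ₖ x)
    swap = solve 3 (λ c s x → (c :* (s :* x)) := (s :* (c :* x))) ≈refl

  sel-yes : ∀ {i n : ℤ} (d : Dec (n ≡ i)) x → n ≡ i → sel d x ≈ x
  sel-yes (yes _) x _  = ≈refl
  sel-yes (no ne) x e = ⊥-elim (ne e)

  sel-no : ∀ {i n : ℤ} (d : Dec (n ≡ i)) x → n ≢ i → sel d x ≈ 0#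
  sel-no (yes e) x ne = ⊥-elim (ne e)
  sel-no (no _)  x _  = ≈refl

  sel-π : (β : Bij) → ∀ a b x → sel (Bij.π⁻¹ β b ≟ a) x ≈ sel (b ≟ Bij.π β a) x
  sel-π β a b x with Bij.π⁻¹ β b ≟ a | b ≟ Bij.π β a
  ... | yes _  | yes _  = ≈refl
  ... | no _   | no _   = ≈refl
  ... | yes e  | no ne = ⊥-elim (ne (dual-π-inv β e))
  ... | no ne | yes e  = ⊥-elim (ne (dual-π-inv′ β e))

  selᶜ : ∀ {i n : ℤ} → Dec (n ≡ i) → K → K
  selᶜ (yes _) _ = 0#
  selᶜ (no _)  x = x

  selᶜ-0 : ∀ {i n : ℤ} (d : Dec (n ≡ i)) {x} → x ≈ 0# → selᶜ d x ≈ 0#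
  selᶜ-0 (yes _) _ = ≈refl
  selᶜ-0 (no _)  e = e

  sel+selᶜ : ∀ (x : ℤ → K) i n → x n ≈ x i *ₖ sel (n ≟ i) 1# +ₖ selᶜ (n ≟ i) (x n)
  sel+selᶜ x i n with n ≟ i
  ... | yes refl = ≈sym (≈trans (+-identityʳ _) (*-identityʳ _))
  ... | no _     = ≈sym (≈trans (+-cong (zeroʳ _) ≈refl) (+-identityˡ _))

  𝐞 : ℤ → Carrier kℤ
  𝐞 m = single _ m tt 1#

  0ᵛ : ∀ {P} → FinSupp P
  0ᵛ = record { coeff = λ _ → 0# ; support = [] ; vanish = λ _ _ → ≈refl ; outside = λ _ _ → ≈refl }

  _·ᵛ_ : ∀ {P} → K → FinSupp P → FinSupp P
  s ·ᵛ x = record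
    { coeff   = λ n → s *ₖ coeff x n
    ; support = support x
    ; vanish  = λ n n∉ → *≈0ʳ (vanish x n n∉)
    ; outside = λ n ¬p → *≈0ʳ (outside x n ¬p) }

  ∉-++⁻ˡ : ∀ {n : ℤ} {l₁ l₂} → n ∉ l₁ ++ l₂ → n ∉ l₁
  ∉-++⁻ˡ n∉ n∈ = n∉ (∈-++⁺ˡ n∈)

  ∉-++⁻ʳ : ∀ {n : ℤ} l₁ {l₂} → n ∉ l₁ ++ l₂ → n ∉ l₂
  ∉-++⁻ʳ l₁ n∉ n∈ = n∉ (∈-++⁺ʳ l₁ n∈)

  _+ᵛ_ : ∀ {P} → FinSupp P → FinSupp P → FinSupp P
  x +ᵛ y = record
    { coeff   = λ n → coeff x n +ₖ coeff y n
    ; support = support x ++ support y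
    ; vanish  = λ n n∉ → ≈trans (+-cong (vanish x n (∉-++⁻ˡ n∉)) (vanish y n (∉-++⁻ʳ (support x) n∉))) 0+0≈0
    ; outside = λ n ¬p → ≈trans (+-cong (outside x n ¬p) (outside y n ¬p)) 0+0≈0 }

  erase : ∀ {P} → ℤ → FinSupp P → FinSupp P
  erase m x = record
    { coeff   = λ n → selᶜ (n ≟ m) (coeff x n)
    ; support = support x
    ; vanish  = λ n n∉ → selᶜ-0 (n ≟ m) (vanish x n n∉)
    ; outside = λ n ¬p → selᶜ-0 (n ≟ m) (outside x n ¬p) }

  line : ∀ {P} → FinSupp P → LinMap kSpace (kSum P)
  line x = record
    { fun         = λ c → lower c ·ᵛ x
    ; resp        = λ (lift e) → lift (λ n → *-cong e ≈refl)
    ; additive    = λ {a} {b} (lift e) → lift (λ n → ≈trans (*-cong e ≈refl) (distrib (lower a) (lower b) (coeff x n)))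
    ; homogeneous = λ {s} {a} (lift e) → lift (λ n → ≈trans (*-cong e ≈refl) (assoc s (lower a) (coeff x n))) }
    where
    distrib : ∀ a b x → (a +ₖ b) *ₖ x ≈ a *ₖ x +ₖ b *ₖ x
    distrib = solve 3 (λ a b x → ((a :+ b) :* x) := ((a :* x) :+ (b :* x))) ≈refl
    assoc : ∀ s a x → (s *ₖ a) *ₖ x ≈ s *ₖ (a *ₖ x)
    assoc = solve 3 (λ s a x → ((s :* a) :* x) := (s :* (a :* x))) ≈refl

  coeff-from-1 : ∀ {P} (f : LinMap kSpace (kSum P)) x n →
                 coeff (fun f x) n ≈ lower x *ₖ coeff (fun f (lift 1#)) n
  coeff-from-1 f x n =
    lower (LinMap.homogeneous f {lower x} {lift 1#} {x} (lift (≈sym (*-identityʳ (lower x))))) n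

  eval : ∀ {V} → LinMap V kSpace → Carrier V → K
  eval f x = lower (fun f x)

  eval-0 : ∀ {P} (f : LinMap (kSum P) kSpace) x → (∀ n → coeff x n ≈ 0#) → eval f x ≈ 0#
  eval-0 f x x≈0 = ≈trans (lower (LinMap.homogeneous f {0#} {x} {x} (lift x≈0·x))) (zeroˡ _)
    where x≈0·x = λ n → ≈trans (x≈0 n) (≈sym (*≈0ʳ (x≈0 n)))

  dot : List ℤ → (ℤ → K) → (ℤ → K) → K
  dot []      x w = 0#
  dot (a ∷ l) x w = x a *ₖ w a +ₖ dot l x w

  dot-cong : ∀ l {x y w v} → (∀ a → a ∈ l → x a *ₖ w a ≈ y a *ₖ v a) → dot l x w ≈ dot l y v
  dot-cong []      h = ≈refl
  dot-cong (a ∷ l) h = +-cong (h a (here refl)) (dot-cong l (λ b b∈ → h b (there b∈)))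

  dot-zero : ∀ l {x w} → (∀ a → a ∈ l → x a *ₖ w a ≈ 0#) → dot l x w ≈ 0#
  dot-zero []      h = ≈refl
  dot-zero (a ∷ l) h = ≈trans (+-cong (h a (here refl)) (dot-zero l (λ b b∈ → h b (there b∈)))) 0+0≈0

  dot-+ˡ : ∀ l {x y z w} → (∀ a → z a ≈ x a +ₖ y a) → dot l z w ≈ dot l x w +ₖ dot l y w
  dot-+ˡ []      h = ≈sym 0+0≈0
  dot-+ˡ (a ∷ l) {x} {y} {z} {w} h =
    ≈trans (+-cong (*-cong (h a) ≈refl) (dot-+ˡ l h)) (shuffle (x a) (y a) (w a) (dot l x w) (dot l y w))
    where
    shuffle : ∀ p q r s t → (p +ₖ q) *ₖ r +ₖ (s +ₖ t) ≈ (p *ₖ r +ₖ s) +ₖ (q *ₖ r +ₖ t)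
    shuffle = solve 5 (λ p q r s t → ((p :+ q) :* r :+ (s :+ t)) := ((p :* r :+ s) :+ (q :* r :+ t))) ≈refl

  dot-*ˡ : ∀ l {s x z w} → (∀ a → z a ≈ s *ₖ x a) → dot l z w ≈ s *ₖ dot l x w
  dot-*ˡ []      {s} h = ≈sym (zeroʳ s)
  dot-*ˡ (a ∷ l) {s} {x} {z} {w} h =
    ≈trans (+-cong (*-cong (h a) ≈refl) (dot-*ˡ l h)) (shuffle s (x a) (w a) (dot l x w))
    where
    shuffle : ∀ s p r t → (s *ₖ p) *ₖ r +ₖ s *ₖ t ≈ s *ₖ (p *ₖ r +ₖ t)
    shuffle = solve 4 (λ s p r t → ((s :* p) :* r :+ s :* t) := (s :* (p :* r :+ t))) ≈refl

  dot-+ʳ : ∀ l {x w u v} → (∀ a → w a ≈ u a +ₖ v a) → dot l x w ≈ dot l x u +ₖ dot l x v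
  dot-+ʳ []      h = ≈sym 0+0≈0
  dot-+ʳ (a ∷ l) {x} {w} {u} {v} h =
    ≈trans (+-cong (*-cong ≈refl (h a)) (dot-+ʳ l h)) (shuffle (x a) (u a) (v a) (dot l x u) (dot l x v))
    where
    shuffle : ∀ p q r s t → p *ₖ (q +ₖ r) +ₖ (s +ₖ t) ≈ (p *ₖ q +ₖ s) +ₖ (p *ₖ r +ₖ t)
    shuffle = solve 5 (λ p q r s t → (p :* (q :+ r) :+ (s :+ t)) := ((p :* q :+ s) :+ (p :* r :+ t))) ≈refl

  dot-*ʳ : ∀ l {s x w v} → (∀ a → v a ≈ s *ₖ w a) → dot l x v ≈ s *ₖ dot l x w
  dot-*ʳ []      {s} h = ≈sym (zeroʳ s)
  dot-*ʳ (a ∷ l) {s} {x} {w} {v} h =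
    ≈trans (+-cong (*-cong ≈refl (h a)) (dot-*ʳ l h)) (shuffle s (x a) (w a) (dot l x w))
    where
    shuffle : ∀ s p r t → p *ₖ (s *ₖ r) +ₖ s *ₖ t ≈ s *ₖ (p *ₖ r +ₖ t)
    shuffle = solve 4 (λ s p r t → (p :* (s :* r) :+ s :* t) := (s :* (p :* r :+ t))) ≈refl

  dot-δ-∉ : ∀ l b {c w} → b ∉ l → dot l (λ a → sel (a ≟ b) c) w ≈ 0#
  dot-δ-∉ l b {c} b∉ = dot-zero l (λ a a∈ → *≈0ˡ (sel-no (a ≟ b) c (λ { refl → b∉ a∈ })))

  dot-δ-interval : ∀ m lo b {c w} → b ∈ interval lo m →
                   dot (interval lo m) (λ a → sel (a ≟ b) c) w ≈ c *ₖ w b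
  dot-δ-interval (ℕ.suc m) lo .lo {c} (here refl) =
    ≈trans (+-cong (*-cong (sel-yes (lo ≟ lo) c refl) ≈refl)
                   (dot-δ-∉ (interval (lo + 1ℤ) m) lo (∉-interval-suc m lo)))
           (+-identityʳ _)
  dot-δ-interval (ℕ.suc m) lo b {c} (there b∈) =
    ≈trans (+-cong (*≈0ˡ (sel-no (lo ≟ b) c (λ { refl → ∉-interval-suc m lo b∈ })))
                   (dot-δ-interval m (lo + 1ℤ) b b∈))
           (+-identityˡ _)

  dotMap : ∀ {P} → List ℤ → (ℤ → ℤ) → (ℤ → K) → LinMap (kSum P) kSpace
  dotMap l g w = record
    { fun         = λ x → lift (dot l (λ a → coeff x (g a)) w)
    ; resp        = λ (lift h) → lift (dot-cong l (λ a _ → *-cong (h (g a)) ≈refl))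
    ; additive    = λ (lift h) → lift (dot-+ˡ l (λ a → h (g a)))
    ; homogeneous = λ (lift h) → lift (dot-*ˡ l (λ a → h (g a))) }

  kℤ-functional-ext : (f g : LinMap kℤ kSpace) → (∀ m → eval f (𝐞 m) ≈ eval g (𝐞 m)) →
                      ∀ x → eval f x ≈ eval g x
  kℤ-functional-ext f g f≈g x = go (support x) x (vanish x)
    where
    go : ∀ l x → (∀ n → n ∉ l → coeff x n ≈ 0#) → eval f x ≈ eval g x
    go []      x x≈0 = ≈trans (eval-0 f x (λ n → x≈0 n (λ ()))) (≈sym (eval-0 g x (λ n → x≈0 n (λ ()))))
    go (m ∷ l) x x≈0 = begin
        eval f x                                  ≈⟨ lower (LinMap.additive f split) ⟩
        eval f v +ₖ eval f x′                     ≈⟨ +-cong (lower (LinMap.homogeneous f scale)) ih ⟩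
        coeff x m *ₖ eval f (𝐞 m) +ₖ eval g x′    ≈⟨ +-cong (*-cong ≈refl (f≈g m)) ≈refl ⟩
        coeff x m *ₖ eval g (𝐞 m) +ₖ eval g x′    ≈⟨ +-cong (lower (LinMap.homogeneous g scale)) ≈refl ⟨
        eval g v +ₖ eval g x′                     ≈⟨ lower (LinMap.additive g split) ⟨
        eval g x                                  ∎
      where
      x′ = erase m x
      v = coeff x m ·ᵛ 𝐞 m
      split : Space.Sum kℤ v x′ x
      split = lift (sel+selᶜ (coeff x) m)
      scale : Space.Scale kℤ (coeff x m) (𝐞 m) v
      scale = lift (λ n → ≈refl)
      ih : eval f x′ ≈ eval g x′
      ih = go l x′ x′≈0
        where
        x′≈0 : ∀ n → n ∉ l → selᶜ (n ≟ m) (coeff x n) ≈ 0#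
        x′≈0 n n∉ with n ≟ m
        ... | yes _ = ≈refl
        ... | no ne = x≈0 n (λ { (here e) → ne e ; (there n∈) → n∉ n∈ })

  LinMap-∘ : ∀ {V U W} → LinMap U W → LinMap V U → LinMap V W
  LinMap-∘ g f = record
    { fun         = λ x → fun g (fun f x)
    ; resp        = λ e → LinMap.resp g (LinMap.resp f e)
    ; additive    = λ s → LinMap.additive g (LinMap.additive f s)
    ; homogeneous = λ s → LinMap.homogeneous g (LinMap.homogeneous f s) }

  -- Spaces carry no axioms, so composing isomorphisms needs transitivity of ≋ at both ends.
  record Transitive≋ (V : Space) : Set L₀ where
    field ≋-trans : ∀ {x y z} → Space._≋_ V x y → Space._≋_ V y z → Space._≋_ V x z

  LinIso-trans : ∀ {V U W} → LinIso V U → LinIso U W → Transitive≋ V → Transitive≋ W → LinIso V W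
  LinIso-trans f g trans-V trans-W = record
    { to      = LinMap-∘ (LinIso.to g) (LinIso.to f)
    ; from    = LinMap-∘ (LinIso.from f) (LinIso.from g)
    ; to∘from = λ w → Transitive≋.≋-trans trans-W
                        (LinMap.resp (LinIso.to g) (LinIso.to∘from f (fun (LinIso.from g) w)))
                        (LinIso.to∘from g w)
    ; from∘to = λ v → Transitive≋.≋-trans trans-V
                        (LinMap.resp (LinIso.from f) (LinIso.from∘to g (fun (LinIso.to f) v)))
                        (LinIso.from∘to f v) }

  Dual-≋-trans : ∀ V → Transitive≋ (Dual V)
  Dual-≋-trans V = record { ≋-trans = λ p q v → lift (≈trans (lower (p v)) (lower (q v))) }

  module Matching (Q : PerfectMatching) (p₁ p₂ : ℤ) where
    open PerfectMatching Q using (bij)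

    𝓜 : Diagram
    𝓜 = M Q (p₁ , p₂)

    H¹-≋-pointwise : ∀ (x₁ x₂ y₁ y₂ : Carrier kℤ) → (∀ n → coeff x₁ n ≈ coeff y₁ n) →
                     (∀ n → coeff x₂ n ≈ coeff y₂ n) → Space._≋_ (H¹ 𝓜) (x₁ , x₂) (y₁ , y₂)
    H¹-≋-pointwise x₁ x₂ y₁ y₂ h₁ h₂ = 0ᵛ , 0ᵛ , 0ᵛ , y₁ , y₂
      , lift (λ n → ≈trans (≈sym (h₁ n)) (≈sym (+-identityʳ _))) , lift (λ n → ≈sym (+-identityʳ _))
      , lift (λ n → ≈trans (≈sym (h₂ n)) (≈sym (+-identityʳ _))) , lift (λ n → ≈sym (+-identityʳ _))

    H¹-≋-refl : ∀ (x₁ x₂ : Carrier kℤ) → Space._≋_ (H¹ 𝓜) (x₁ , x₂) (x₁ , x₂)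
    H¹-≋-refl x₁ x₂ = H¹-≋-pointwise x₁ x₂ x₁ x₂ (λ _ → ≈refl) (λ _ → ≈refl)

    H¹-Sum-pointwise : ∀ (x₁ x₂ y₁ y₂ z₁ z₂ : Carrier kℤ) →
                       (∀ n → coeff z₁ n ≈ coeff x₁ n +ₖ coeff y₁ n) →
                       (∀ n → coeff z₂ n ≈ coeff x₂ n +ₖ coeff y₂ n) →
                       Space.Sum (H¹ 𝓜) (x₁ , x₂) (y₁ , y₂) (z₁ , z₂)
    H¹-Sum-pointwise x₁ x₂ y₁ y₂ z₁ z₂ h₁ h₂ = z₁ , z₂ , lift h₁ , lift h₂ , H¹-≋-refl z₁ z₂

    H¹-Scale-pointwise : ∀ {s} (x₁ x₂ z₁ z₂ : Carrier kℤ) →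
                         (∀ n → coeff z₁ n ≈ s *ₖ coeff x₁ n) → (∀ n → coeff z₂ n ≈ s *ₖ coeff x₂ n) →
                         Space.Scale (H¹ 𝓜) s (x₁ , x₂) (z₁ , z₂)
    H¹-Scale-pointwise x₁ x₂ z₁ z₂ h₁ h₂ = z₁ , z₂ , lift h₁ , lift h₂ , H¹-≋-refl z₁ z₂

    evalH¹ : LinMap (H¹ 𝓜) kSpace → Carrier kℤ → Carrier kℤ → K
    evalH¹ h x₁ x₂ = eval h (x₁ , x₂)

    evalH¹-0 : ∀ h → evalH¹ h 0ᵛ 0ᵛ ≈ 0#
    evalH¹-0 h = ≈trans (lower (LinMap.homogeneous h {0#} {0ᵛ , 0ᵛ} {0ᵛ , 0ᵛ}
                   (H¹-Scale-pointwise 0ᵛ 0ᵛ 0ᵛ 0ᵛ (λ _ → ≈sym (zeroˡ 0#)) (λ _ → ≈sym (zeroˡ 0#)))))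
                 (zeroˡ _)

    evalH¹-split : ∀ h x₁ x₂ → evalH¹ h x₁ x₂ ≈ evalH¹ h x₁ 0ᵛ +ₖ evalH¹ h 0ᵛ x₂
    evalH¹-split h x₁ x₂ = lower (LinMap.additive h
      (H¹-Sum-pointwise x₁ 0ᵛ 0ᵛ x₂ x₁ x₂ (λ _ → ≈sym (+-identityʳ _)) (λ _ → ≈sym (+-identityˡ _))))

    onA₁ : LinMap (H¹ 𝓜) kSpace → LinMap kℤ kSpace
    onA₁ h = record
      { fun         = λ x → lift (evalH¹ h x 0ᵛ)
      ; resp        = λ {x} {y} (lift e) → LinMap.resp h (H¹-≋-pointwise x 0ᵛ y 0ᵛ e (λ _ → ≈refl))
      ; additive    = λ {x} {y} {z} (lift e) →
          LinMap.additive h (H¹-Sum-pointwise x 0ᵛ y 0ᵛ z 0ᵛ e (λ _ → ≈sym 0+0≈0))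
      ; homogeneous = λ {s} {x} {z} (lift e) →
          LinMap.homogeneous h (H¹-Scale-pointwise x 0ᵛ z 0ᵛ e (λ _ → ≈sym (zeroʳ s))) }

    onA₂ : LinMap (H¹ 𝓜) kSpace → LinMap kℤ kSpace
    onA₂ h = record
      { fun         = λ y → lift (-ₖ evalH¹ h 0ᵛ y)
      ; resp        = λ {x} {y} (lift e) →
          lift (-‿cong (lower (LinMap.resp h (H¹-≋-pointwise 0ᵛ x 0ᵛ y (λ _ → ≈refl) e))))
      ; additive    = λ {x} {y} {z} (lift e) → lift (≈trans
          (-‿cong (lower (LinMap.additive h (H¹-Sum-pointwise 0ᵛ x 0ᵛ y 0ᵛ z (λ _ → ≈sym 0+0≈0) e))))
          (-‿+-distrib _ _))
      ; homogeneous = λ {s} {x} {z} (lift e) → lift (≈trans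
          (-‿cong (lower (LinMap.homogeneous h (H¹-Scale-pointwise 0ᵛ x 0ᵛ z (λ _ → ≈sym (zeroʳ s)) e))))
          (-‿distribʳ-* _ _)) }

    functional⇒morphism : LinMap (H¹ 𝓜) kSpace → Mor 𝓜 kDiag/B₁B₂
    functional⇒morphism h = record
      { φB₁ = toZero ; φB₂ = toZero ; φB₃ = onA₁ h ; φA₁ = onA₁ h ; φA₂ = onA₂ h
      ; sq₁₁ = λ x → lift (≈sym (≈trans (lower (LinMap.resp h (ρ₁₁-coboundary x))) (evalH¹-0 h)))
      ; sq₂₂ = λ y → lift (≈sym (≈trans (-‿cong (≈trans (lower (LinMap.resp h (ρ₂₂-coboundary y)))
                                                        (evalH¹-0 h))) ε⁻¹≈ε))
      ; sq₃₁ = λ x → lift ≈refl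
      ; sq₃₂ = λ x → lift (inverseˡ-unique _ _
                 (≈trans (≈sym (evalH¹-split h x (fun (reindex bij) x)))
                         (≈trans (≈sym (lower (LinMap.resp h (ρ₃-coboundary x)))) (evalH¹-0 h)))) }
      where
      ρ₁₁-coboundary : ∀ x → Space._≋_ (H¹ 𝓜) (fun (incl p₁) x , 0ᵛ) (0ᵛ , 0ᵛ)
      ρ₁₁-coboundary x = x , 0ᵛ , 0ᵛ , fun (incl p₁) x , 0ᵛ
        , lift (λ _ → ≈sym (+-identityʳ _)) , lift (λ _ → ≈sym (+-identityˡ _))
        , lift (λ _ → ≈sym 0+0≈0) , lift (λ _ → ≈sym 0+0≈0)
      ρ₂₂-coboundary : ∀ y → Space._≋_ (H¹ 𝓜) (0ᵛ , fun (incl p₂) y) (0ᵛ , 0ᵛ)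
      ρ₂₂-coboundary y = 0ᵛ , y , 0ᵛ , 0ᵛ , fun (incl p₂) y
        , lift (λ _ → ≈sym 0+0≈0) , lift (λ _ → ≈sym 0+0≈0)
        , lift (λ _ → ≈sym (+-identityʳ _)) , lift (λ _ → ≈sym (+-identityˡ _))
      ρ₃-coboundary : ∀ x → Space._≋_ (H¹ 𝓜) (0ᵛ , 0ᵛ) (x , fun (reindex bij) x)
      ρ₃-coboundary x = 0ᵛ , 0ᵛ , x , x , fun (reindex bij) x
        , lift (λ _ → ≈sym (+-identityˡ _)) , lift (λ _ → ≈sym (+-identityʳ _))
        , lift (λ _ → ≈sym (+-identityˡ _)) , lift (λ _ → ≈sym (+-identityʳ _))

    toMorphism : LinMap (Dual (H¹ 𝓜)) (HomSpace 𝓜 kDiag/B₁B₂)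
    toMorphism = record
      { fun         = functional⇒morphism
      ; resp        = λ E → (λ _ → tt) , (λ _ → tt) , (λ x → E (x , 0ᵛ)) , (λ x → E (x , 0ᵛ))
                          , (λ y → lift (-‿cong (lower (E (0ᵛ , y)))))
      ; additive    = λ E → (λ _ → tt) , (λ _ → tt) , (λ x → E (x , 0ᵛ)) , (λ x → E (x , 0ᵛ))
                          , (λ y → lift (≈trans (-‿cong (lower (E (0ᵛ , y)))) (-‿+-distrib _ _)))
      ; homogeneous = λ E → (λ _ → tt) , (λ _ → tt) , (λ x → E (x , 0ᵛ)) , (λ x → E (x , 0ᵛ))
                          , (λ y → lift (≈trans (-‿cong (lower (E (0ᵛ , y)))) (-‿distribʳ-* _ _))) }

    A₁-minus-A₂ : Mor 𝓜 kDiag/B₁B₂ → Carrier kℤ → Carrier kℤ → K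
    A₁-minus-A₂ φ x₁ x₂ = eval (φA₁ φ) x₁ -ₖ eval (φA₂ φ) x₂

    -- φ kills the coboundaries since φ vanishes on B₁, B₂ and φA₁ ρ₃₁ = φB₃ = φA₂ ρ₃₂.
    A₁-minus-A₂-resp : ∀ φ {x y} → Space._≋_ (H¹ 𝓜) x y →
                       A₁-minus-A₂ φ (proj₁ x) (proj₂ x) ≈ A₁-minus-A₂ φ (proj₁ y) (proj₂ y)
    A₁-minus-A₂-resp φ {x₁ , x₂} {y₁ , y₂} (c₁ , c₂ , c₃ , u₁ , u₂ , s₁ , s₂ , s₃ , s₄) = begin
        A₁ x₁ -ₖ A₂ x₂                                          ≈⟨ [x+t]-[y+t]≈x-y _ _ _ ⟨
        (A₁ x₁ +ₖ A₁ c₃) -ₖ (A₂ x₂ +ₖ A₁ c₃)                    ≈⟨ −-cong (≈sym e₁) (+-cong ≈refl ρ₃-square) ⟩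
        A₁ u₁ -ₖ (A₂ x₂ +ₖ A₂ (fun (reindex bij) c₃))           ≈⟨ −-cong e₂ (≈sym e₃) ⟩
        (A₁ y₁ +ₖ A₁ (fun (incl p₁) c₁)) -ₖ A₂ u₂               ≈⟨ −-cong (+-cong ≈refl ρ₁₁-zero) e₄ ⟩
        (A₁ y₁ +ₖ 0#) -ₖ (A₂ y₂ +ₖ A₂ (fun (incl p₂) c₂))       ≈⟨ −-cong (+-identityʳ _)
                                                                     (≈trans (+-cong ≈refl ρ₂₂-zero) (+-identityʳ _)) ⟩
        A₁ y₁ -ₖ A₂ y₂                                          ∎
      where
      A₁ = eval (φA₁ φ)
      A₂ = eval (φA₂ φ)
      e₁ = lower (LinMap.additive (φA₁ φ) s₁)
      e₂ = lower (LinMap.additive (φA₁ φ) s₂)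
      e₃ = lower (LinMap.additive (φA₂ φ) s₃)
      e₄ = lower (LinMap.additive (φA₂ φ) s₄)
      ρ₃-square : A₁ c₃ ≈ A₂ (fun (reindex bij) c₃)
      ρ₃-square = ≈trans (≈sym (lower (sq₃₁ φ c₃))) (lower (sq₃₂ φ c₃))
      ρ₁₁-zero : A₁ (fun (incl p₁) c₁) ≈ 0#
      ρ₁₁-zero = ≈sym (lower (sq₁₁ φ c₁))
      ρ₂₂-zero : A₂ (fun (incl p₂) c₂) ≈ 0#
      ρ₂₂-zero = ≈sym (lower (sq₂₂ φ c₂))

    morphism⇒functional : Mor 𝓜 kDiag/B₁B₂ → LinMap (H¹ 𝓜) kSpace
    morphism⇒functional φ = record
      { fun         = λ x → lift (A₁-minus-A₂ φ (proj₁ x) (proj₂ x))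
      ; resp        = λ e → lift (A₁-minus-A₂-resp φ e)
      ; additive    = λ {x} {y} {z} (w₁ , w₂ , S₁ , S₂ , w≋z) →
          lift (≈trans (≈sym (A₁-minus-A₂-resp φ {w₁ , w₂} {z} w≋z))
                 (≈trans (−-cong (lower (LinMap.additive (φA₁ φ) S₁)) (lower (LinMap.additive (φA₂ φ) S₂)))
                         ([a+b]-[c+d]≈[a-c]+[b-d] _ _ _ _)))
      ; homogeneous = λ {s} {x} {z} (w₁ , w₂ , S₁ , S₂ , w≋z) →
          lift (≈trans (≈sym (A₁-minus-A₂-resp φ {w₁ , w₂} {z} w≋z))
                 (≈trans (−-cong (lower (LinMap.homogeneous (φA₁ φ) S₁)) (lower (LinMap.homogeneous (φA₂ φ) S₂)))
                         (*-distribˡ-− _ _ _))) }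

    toFunctional : LinMap (HomSpace 𝓜 kDiag/B₁B₂) (Dual (H¹ 𝓜))
    toFunctional = record
      { fun         = morphism⇒functional
      ; resp        = λ (_ , _ , _ , h₄ , h₅) x →
          lift (−-cong (lower (h₄ (proj₁ x))) (lower (h₅ (proj₂ x))))
      ; additive    = λ (_ , _ , _ , h₄ , h₅) x →
          lift (≈trans (−-cong (lower (h₄ (proj₁ x))) (lower (h₅ (proj₂ x)))) ([a+b]-[c+d]≈[a-c]+[b-d] _ _ _ _))
      ; homogeneous = λ (_ , _ , _ , h₄ , h₅) x →
          lift (≈trans (−-cong (lower (h₄ (proj₁ x))) (lower (h₅ (proj₂ x)))) (*-distribˡ-− _ _ _)) }

    Dual-H¹≅Hom-k/B₁B₂ : LinIso (Dual (H¹ 𝓜)) (HomSpace 𝓜 kDiag/B₁B₂)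
    Dual-H¹≅Hom-k/B₁B₂ = record
      { to      = toMorphism
      ; from    = toFunctional
      ; to∘from = λ φ →
          let φA₁0 = eval-0 (φA₁ φ) 0ᵛ (λ _ → ≈refl)
              φA₂0 = eval-0 (φA₂ φ) 0ᵛ (λ _ → ≈refl)
          in (λ _ → tt) , (λ _ → tt)
           , (λ x → lift (≈trans (−-cong ≈refl φA₂0) (≈trans (x-0≈x _) (≈sym (lower (sq₃₁ φ x))))))
           , (λ x → lift (≈trans (−-cong ≈refl φA₂0) (x-0≈x _)))
           , (λ y → lift (≈trans (-‿cong (−-cong φA₁0 ≈refl)) (-[0-x]≈x _)))
      ; from∘to = λ h x → lift (≈trans (x--y≈x+y _ _) (≈sym (evalH¹-split h (proj₁ x) (proj₂ x)))) }

    valueAt1 : Mor kDiag 𝓜 → Ker∂ 𝓜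
    valueAt1 ψ = record
      { b₁ = fun (φB₁ ψ) 1ᵏ ; b₂ = fun (φB₂ ψ) 1ᵏ ; b₃ = fun (φB₃ ψ) 1ᵏ
      ; ∂b≡0₁ = lift (λ n → ≈trans (lower (sq₁₁ ψ 1ᵏ) n) (≈sym (lower (sq₃₁ ψ 1ᵏ) n)))
      ; ∂b≡0₂ = lift (λ n → ≈trans (lower (sq₂₂ ψ 1ᵏ) n) (≈sym (lower (sq₃₂ ψ 1ᵏ) n))) }
      where 1ᵏ = lift 1#

    cocycle⇒morphism : Ker∂ 𝓜 → Mor kDiag 𝓜
    cocycle⇒morphism b = record
      { φB₁ = line b₁ ; φB₂ = line b₂ ; φB₃ = line b₃
      ; φA₁ = line b₃ ; φA₂ = line (fun (incl p₂) b₂)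
      ; sq₁₁ = λ _ → lift (λ n → *-cong ≈refl (lower ∂b≡0₁ n))
      ; sq₂₂ = λ _ → lift (λ _ → ≈refl)
      ; sq₃₁ = λ _ → lift (λ _ → ≈refl)
      ; sq₃₂ = λ _ → lift (λ n → *-cong ≈refl (≈sym (lower ∂b≡0₂ n))) }
      where open Ker∂ b

    Hom-k≅H⁰ : LinIso (HomSpace kDiag 𝓜) (H⁰ 𝓜)
    Hom-k≅H⁰ = record
      { to = record
          { fun         = valueAt1
          ; resp        = λ (h₁ , h₂ , h₃ , _ , _) → h₁ 1ᵏ , h₂ 1ᵏ , h₃ 1ᵏ
          ; additive    = λ (h₁ , h₂ , h₃ , _ , _) → h₁ 1ᵏ , h₂ 1ᵏ , h₃ 1ᵏ
          ; homogeneous = λ (h₁ , h₂ , h₃ , _ , _) → h₁ 1ᵏ , h₂ 1ᵏ , h₃ 1ᵏ }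
      ; from = record
          { fun         = cocycle⇒morphism
          ; resp        = λ (lift e₁ , lift e₂ , lift e₃) →
                (λ _ → lift (λ n → *-cong ≈refl (e₁ n))) , (λ _ → lift (λ n → *-cong ≈refl (e₂ n)))
              , (λ _ → lift (λ n → *-cong ≈refl (e₃ n))) , (λ _ → lift (λ n → *-cong ≈refl (e₃ n)))
              , (λ _ → lift (λ n → *-cong ≈refl (e₂ n)))
          ; additive    = λ (lift e₁ , lift e₂ , lift e₃) →
                (λ x → lift (λ n → *-preserves-Sum (lower x) (e₁ n)))
              , (λ x → lift (λ n → *-preserves-Sum (lower x) (e₂ n)))
              , (λ x → lift (λ n → *-preserves-Sum (lower x) (e₃ n)))
              , (λ x → lift (λ n → *-preserves-Sum (lower x) (e₃ n)))
              , (λ x → lift (λ n → *-preserves-Sum (lower x) (e₂ n)))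
          ; homogeneous = λ (lift e₁ , lift e₂ , lift e₃) →
                (λ x → lift (λ n → *-preserves-Scale (lower x) (e₁ n)))
              , (λ x → lift (λ n → *-preserves-Scale (lower x) (e₂ n)))
              , (λ x → lift (λ n → *-preserves-Scale (lower x) (e₃ n)))
              , (λ x → lift (λ n → *-preserves-Scale (lower x) (e₃ n)))
              , (λ x → lift (λ n → *-preserves-Scale (lower x) (e₂ n))) }
      ; to∘from = λ _ → lift (λ _ → *-identityˡ _) , lift (λ _ → *-identityˡ _) , lift (λ _ → *-identityˡ _)
      ; from∘to = λ ψ →
            (λ x → lift (λ n → ≈sym (coeff-from-1 (φB₁ ψ) x n)))
          , (λ x → lift (λ n → ≈sym (coeff-from-1 (φB₂ ψ) x n)))
          , (λ x → lift (λ n → ≈sym (coeff-from-1 (φB₃ ψ) x n)))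
          , (λ x → lift (λ n → ≈trans (≈sym (coeff-from-1 (φB₃ ψ) x n)) (lower (sq₃₁ ψ x) n)))
          , (λ x → lift (λ n → ≈trans (≈sym (coeff-from-1 (φB₂ ψ) x n)) (lower (sq₂₂ ψ x) n))) }
      where 1ᵏ = lift 1#

    Hom-≋-trans : ∀ 𝓕 → Transitive≋ (HomSpace 𝓕 𝓜)
    Hom-≋-trans 𝓕 = record { ≋-trans = λ (p₁ , p₂ , p₃ , p₄ , p₅) (q₁ , q₂ , q₃ , q₄ , q₅) →
        (λ v → lift (λ n → ≈trans (lower (p₁ v) n) (lower (q₁ v) n)))
      , (λ v → lift (λ n → ≈trans (lower (p₂ v) n) (lower (q₂ v) n)))
      , (λ v → lift (λ n → ≈trans (lower (p₃ v) n) (lower (q₃ v) n)))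
      , (λ v → lift (λ n → ≈trans (lower (p₄ v) n) (lower (q₄ v) n)))
      , (λ v → lift (λ n → ≈trans (lower (p₅ v) n) (lower (q₅ v) n))) }

    H⁰-≋-trans : Transitive≋ (H⁰ 𝓜)
    H⁰-≋-trans = record { ≋-trans = λ (lift p₁ , lift p₂ , lift p₃) (lift q₁ , lift q₂ , lift q₃) →
      lift (λ n → ≈trans (p₁ n) (q₁ n)) , lift (λ n → ≈trans (p₂ n) (q₂ n)) , lift (λ n → ≈trans (p₃ n) (q₃ n)) }

  module Duality (P : PerfectMatching) (K₁ K₂ d₁ d₂ : ℤ) where
    open PerfectMatching P using (bij; π; π⁻¹; π∘π⁻¹; π⁻¹∘π; W-on; bounded)

    L₁ L₂ q₁ q₂ : ℤ
    L₁ = K₁ + 1ℤ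
    L₂ = K₂ + 1ℤ
    q₁ = K₁ - d₁
    q₂ = K₂ - d₂

    β* : Bij
    β* = dualBij (L₁ , L₂) bij

    π* π*⁻¹ : ℤ → ℤ
    π*   = Bij.π β*
    π*⁻¹ = Bij.π⁻¹ β*

    P* : PerfectMatching
    P* = dualPM (L₁ , L₂) P

    Md M*d : Diagram
    Md  = M P (d₁ , d₂)
    M*d = M P* (q₁ , q₂)

    π*-reflect : ∀ a → π* (L₁ - a) ≡ L₂ - π a
    π*-reflect a = cong (λ t → L₂ - π t) (sub-sub L₁ a)

    π-reflect : ∀ b → π (L₁ - π*⁻¹ b) ≡ L₂ - b
    π-reflect b = trans (cong π (sub-sub L₁ _)) (π∘π⁻¹ (L₂ - b))

    reflect : ℤ → ℤ
    reflect n = L₁ - n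

    N : ℕ.ℕ
    N = proj₁ bounded

    matched-bound : ∀ a → ∣ a + π a ∣ ℕ.≤ N
    matched-bound a = ℕP.≮⇒≥ (λ N<∣a+πa∣ →
      1≢0 (trans (sym (W-on a (π a) refl)) (proj₂ bounded a (π a) N<∣a+πa∣)))
      where
      1≢0 : + 1 ≢ + 0
      1≢0 ()

    -- S contains every a with a ≥ d₁ + 1, π a ≥ d₂ + 1, and T every a with a ≤ d₁, π a ≤ d₂;
    -- finite lists suffice because |a + π a| ≤ N.
    S T : List ℤ
    S = closedInterval (d₁ + 1ℤ) (+ N - (d₂ + 1ℤ))
    T = closedInterval (- (+ N) - d₂) d₁

    ∈S : ∀ {a} → d₁ + 1ℤ ≤ a → d₂ + 1ℤ ≤ π a → a ∈ S
    ∈S {a} h₁ h₂ = ∈-closedInterval {hi = + N - (d₂ + 1ℤ)} h₁ (≤-from-gap _ (gap (+ N) a (π a) d₂)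
      (ℤP.+-mono-≤ (ℤP.i≤j⇒0≤j-i (∣i∣≤n⇒i≤n (a + π a) N (matched-bound a))) (ℤP.i≤j⇒0≤j-i h₂)))
      where
      gap : ∀ N a b d → (N - (a + b)) + (b - (d + 1ℤ)) ≡ (N - (d + 1ℤ)) - a
      gap = solve-∀

    ∈T : ∀ {a} → a ≤ d₁ → π a ≤ d₂ → a ∈ T
    ∈T {a} h₁ h₂ = ∈-closedInterval {lo = - (+ N) - d₂} (≤-from-gap _ (gap (+ N) a (π a) d₂)
      (ℤP.+-mono-≤ (ℤP.i≤j⇒0≤j-i (∣i∣≤n⇒-n≤i (a + π a) N (matched-bound a))) (ℤP.i≤j⇒0≤j-i h₂))) h₁
      where
      gap : ∀ N a b d → ((a + b) - (- N)) + (d - b) ≡ a - (- N - d)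
      gap = solve-∀

    ∈S⇒>d₁ : ∀ {a} → a ∈ S → d₁ + 1ℤ ≤ a
    ∈S⇒>d₁ = ∈-interval⇒≥ _

    module SupportedOnS (w : ℤ → K) (w≈0₁ : ∀ a → a ≤ d₁ → w a ≈ 0#)
                        (w≈0₂ : ∀ a → π a ≤ d₂ → w a ≈ 0#) where
      vanishes-off-S : ∀ a → a ∉ S → w a ≈ 0#
      vanishes-off-S a a∉ with a ≤? d₁
      ... | yes a≤d₁ = w≈0₁ a a≤d₁
      ... | no a≰d₁ with π a ≤? d₂
      ...   | yes πa≤d₂ = w≈0₂ a πa≤d₂
      ...   | no πa≰d₂  = ⊥-elim (a∉ (∈S (≰⇒+1≤ a≰d₁) (≰⇒+1≤ πa≰d₂)))

      dot-S-δ : ∀ a → dot S (λ b → sel (b ≟ a) 1#) w ≈ w a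
      dot-S-δ a with a ∈? S
      ... | yes a∈ = ≈trans (dot-δ-interval _ _ a a∈) (*-identityˡ _)
      ... | no a∉  = ≈trans (dot-δ-∉ S a a∉) (≈sym (vanishes-off-S a a∉))

      vanishes-off-reflected-S : ∀ n → n ∉ map reflect S → w (L₁ - n) ≈ 0#
      vanishes-off-reflected-S n n∉ =
        vanishes-off-S (L₁ - n) (λ m → n∉ (subst (_∈ map reflect S) (sub-sub L₁ n) (∈-map⁺ reflect m)))

    weight : Mor Md kDiag/B₁B₂ → ℤ → K
    weight φ a = eval (φB₃ φ) (𝐞 a)

    weight-vanishes₁ : ∀ φ a → a ≤ d₁ → weight φ a ≈ 0#
    weight-vanishes₁ φ a a≤d₁ =
      ≈trans (lower (sq₃₁ φ (𝐞 a)))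
        (≈trans (lower (LinMap.resp (φA₁ φ) {𝐞 a} {fun (incl d₁) y} (lift (λ _ → ≈refl))))
                (≈sym (lower (sq₁₁ φ y))))
      where y = single (_≤ d₁) a a≤d₁ 1#

    weight-vanishes₂ : ∀ φ a → π a ≤ d₂ → weight φ a ≈ 0#
    weight-vanishes₂ φ a πa≤d₂ =
      ≈trans (lower (sq₃₂ φ (𝐞 a)))
        (≈trans (lower (LinMap.resp (φA₂ φ) {fun (reindex bij) (𝐞 a)} {fun (incl d₂) y}
                                    (lift (λ n → sel-π bij a n 1#))))
                (≈sym (lower (sq₂₂ φ y))))
      where y = single (_≤ d₂) (π a) πa≤d₂ 1#

    coweight : Mor kDiag M*d → ℤ → K
    coweight ψ n = coeff (fun (φB₃ ψ) (lift 1#)) n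

    coweight-vanishes₁ : ∀ ψ n → ¬ (n ≤ q₁) → coweight ψ n ≈ 0#
    coweight-vanishes₁ ψ n n≰q₁ =
      ≈trans (lower (sq₃₁ ψ 1ᵏ) n) (≈trans (≈sym (lower (sq₁₁ ψ 1ᵏ) n)) (outside (fun (φB₁ ψ) 1ᵏ) n n≰q₁))
      where 1ᵏ = lift 1#

    coweight-vanishes₂ : ∀ ψ n → ¬ (π* n ≤ q₂) → coweight ψ n ≈ 0#
    coweight-vanishes₂ ψ n π*n≰q₂ =
      ≈trans (≈reflexive (cong (coweight ψ) (sym (Bij.π⁻¹∘π β* n))))
        (≈trans (lower (sq₃₂ ψ 1ᵏ) (π* n))
          (≈trans (≈sym (lower (sq₂₂ ψ 1ᵏ) (π* n))) (outside (fun (φB₂ ψ) 1ᵏ) (π* n) π*n≰q₂)))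
      where 1ᵏ = lift 1#

    reflected-coweight : Mor kDiag M*d → ℤ → K
    reflected-coweight ψ a = coweight ψ (L₁ - a)

    reflected-coweight-vanishes₁ : ∀ ψ a → a ≤ d₁ → reflected-coweight ψ a ≈ 0#
    reflected-coweight-vanishes₁ ψ a a≤d₁ = coweight-vanishes₁ ψ (L₁ - a) (≤⇒reflected-≰ K₁ d₁ a a≤d₁)

    reflected-coweight-vanishes₂ : ∀ ψ a → π a ≤ d₂ → reflected-coweight ψ a ≈ 0#
    reflected-coweight-vanishes₂ ψ a πa≤d₂ = coweight-vanishes₂ ψ (L₁ - a)
      (λ h → ≤⇒reflected-≰ K₂ d₂ (π a) πa≤d₂ (subst (_≤ q₂) (π*-reflect a) h))

    reflectedWeight : Mor Md kDiag/B₁B₂ → Carrier kℤ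
    reflectedWeight φ = record
      { coeff   = λ n → weight φ (L₁ - n)
      ; support = map reflect S
      ; vanish  = SupportedOnS.vanishes-off-reflected-S (weight φ) (weight-vanishes₁ φ) (weight-vanishes₂ φ)
      ; outside = λ _ ¬tt → ⊥-elim (¬tt tt) }

    reflectedWeight₁ : Mor Md kDiag/B₁B₂ → FinSupp (_≤ q₁)
    reflectedWeight₁ φ = record
      { coeff   = coeff (reflectedWeight φ)
      ; support = support (reflectedWeight φ)
      ; vanish  = vanish (reflectedWeight φ)
      ; outside = λ n n≰q₁ → weight-vanishes₁ φ (L₁ - n)
          (reflected-≰⇒≤ K₁ d₁ (L₁ - n) (λ h → n≰q₁ (subst (_≤ q₁) (sub-sub L₁ n) h))) }

    reflectedWeight-π : Mor Md kDiag/B₁B₂ → Carrier kℤ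
    reflectedWeight-π φ = fun (reindex β*) (reflectedWeight φ)

    reflectedWeight₂ : Mor Md kDiag/B₁B₂ → FinSupp (_≤ q₂)
    reflectedWeight₂ φ = record
      { coeff   = coeff (reflectedWeight-π φ)
      ; support = support (reflectedWeight-π φ)
      ; vanish  = vanish (reflectedWeight-π φ)
      ; outside = λ b b≰q₂ → weight-vanishes₂ φ (L₁ - π*⁻¹ b)
          (subst (_≤ d₂) (sym (π-reflect b))
                 (reflected-≰⇒≤ K₂ d₂ (L₂ - b) (λ h → b≰q₂ (subst (_≤ q₂) (sub-sub L₂ b) h)))) }

    dualMorphism : Mor Md kDiag/B₁B₂ → Mor kDiag M*d
    dualMorphism φ = record
      { φB₁ = line (reflectedWeight₁ φ) ; φB₂ = line (reflectedWeight₂ φ)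
      ; φB₃ = line (reflectedWeight φ) ; φA₁ = line (reflectedWeight φ) ; φA₂ = line (reflectedWeight-π φ)
      ; sq₁₁ = λ _ → lift (λ _ → ≈refl) ; sq₂₂ = λ _ → lift (λ _ → ≈refl)
      ; sq₃₁ = λ _ → lift (λ _ → ≈refl) ; sq₃₂ = λ _ → lift (λ _ → ≈refl) }

    toDualMorphism : LinMap (HomSpace Md kDiag/B₁B₂) (HomSpace kDiag M*d)
    toDualMorphism = record
      { fun         = dualMorphism
      ; resp        = λ (_ , _ , h₃ , _ , _) →
          let E = λ a → lower (h₃ (𝐞 a))
          in (λ _ → lift (λ n → *-cong ≈refl (E (L₁ - n))))
           , (λ _ → lift (λ n → *-cong ≈refl (E (L₁ - π*⁻¹ n))))
           , (λ _ → lift (λ n → *-cong ≈refl (E (L₁ - n))))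
           , (λ _ → lift (λ n → *-cong ≈refl (E (L₁ - n))))
           , (λ _ → lift (λ n → *-cong ≈refl (E (L₁ - π*⁻¹ n))))
      ; additive    = λ (_ , _ , h₃ , _ , _) →
          let E = λ a → lower (h₃ (𝐞 a))
          in (λ x → lift (λ n → *-preserves-Sum (lower x) (E (L₁ - n))))
           , (λ x → lift (λ n → *-preserves-Sum (lower x) (E (L₁ - π*⁻¹ n))))
           , (λ x → lift (λ n → *-preserves-Sum (lower x) (E (L₁ - n))))
           , (λ x → lift (λ n → *-preserves-Sum (lower x) (E (L₁ - n))))
           , (λ x → lift (λ n → *-preserves-Sum (lower x) (E (L₁ - π*⁻¹ n))))
      ; homogeneous = λ (_ , _ , h₃ , _ , _) →
          let E = λ a → lower (h₃ (𝐞 a))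
          in (λ x → lift (λ n → *-preserves-Scale (lower x) (E (L₁ - n))))
           , (λ x → lift (λ n → *-preserves-Scale (lower x) (E (L₁ - π*⁻¹ n))))
           , (λ x → lift (λ n → *-preserves-Scale (lower x) (E (L₁ - n))))
           , (λ x → lift (λ n → *-preserves-Scale (lower x) (E (L₁ - n))))
           , (λ x → lift (λ n → *-preserves-Scale (lower x) (E (L₁ - π*⁻¹ n)))) }

    predualMorphism : Mor kDiag M*d → Mor Md kDiag/B₁B₂
    predualMorphism ψ = record
      { φB₁ = toZero ; φB₂ = toZero
      ; φB₃ = dotMap S (λ a → a) w ; φA₁ = dotMap S (λ a → a) w ; φA₂ = dotMap S π w
      ; sq₁₁ = λ x → lift (≈sym (dot-zero S (λ a a∈ → *≈0ˡ (outside x a (+1≤⇒≰ (∈S⇒>d₁ a∈))))))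
      ; sq₂₂ = λ y → lift (≈sym (dot-zero S (λ a _ → B₂-term y a)))
      ; sq₃₁ = λ _ → lift ≈refl
      ; sq₃₂ = λ x → lift (dot-cong S (λ a _ → *-cong (≈reflexive (cong (coeff x) (sym (π⁻¹∘π a)))) ≈refl)) }
      where
      w = reflected-coweight ψ
      B₂-term : ∀ (y : FinSupp (_≤ d₂)) a → coeff y (π a) *ₖ w a ≈ 0#
      B₂-term y a with π a ≤? d₂
      ... | yes πa≤d₂ = *≈0ʳ (reflected-coweight-vanishes₂ ψ a πa≤d₂)
      ... | no πa≰d₂  = *≈0ˡ (outside y (π a) πa≰d₂)

    toPredualMorphism : LinMap (HomSpace kDiag M*d) (HomSpace Md kDiag/B₁B₂)
    toPredualMorphism = record
      { fun         = predualMorphism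
      ; resp        = λ (_ , _ , h₃ , _ , _) →
          let E = λ a → lower (h₃ (lift 1#)) (L₁ - a)
          in (λ _ → tt) , (λ _ → tt)
           , (λ _ → lift (dot-cong S (λ a _ → *-cong ≈refl (E a))))
           , (λ _ → lift (dot-cong S (λ a _ → *-cong ≈refl (E a))))
           , (λ _ → lift (dot-cong S (λ a _ → *-cong ≈refl (E a))))
      ; additive    = λ (_ , _ , h₃ , _ , _) →
          let E = λ a → lower (h₃ (lift 1#)) (L₁ - a)
          in (λ _ → tt) , (λ _ → tt)
           , (λ _ → lift (dot-+ʳ S E)) , (λ _ → lift (dot-+ʳ S E)) , (λ _ → lift (dot-+ʳ S E))
      ; homogeneous = λ (_ , _ , h₃ , _ , _) →
          let E = λ a → lower (h₃ (lift 1#)) (L₁ - a)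
          in (λ _ → tt) , (λ _ → tt)
           , (λ _ → lift (dot-*ʳ S E)) , (λ _ → lift (dot-*ʳ S E)) , (λ _ → lift (dot-*ʳ S E)) }

    dual∘predual : ∀ ψ → Space._≋_ (HomSpace kDiag M*d) (dualMorphism (predualMorphism ψ)) ψ
    dual∘predual ψ =
        (λ x → lift (λ n → ≈trans (on-B₃ x n) (≈trans (lower (sq₃₁ ψ x) n) (≈sym (lower (sq₁₁ ψ x) n)))))
      , (λ x → lift (λ b → ≈trans (on-B₃ x (π*⁻¹ b)) (≈trans (lower (sq₃₂ ψ x) b) (≈sym (lower (sq₂₂ ψ x) b)))))
      , (λ x → lift (λ n → on-B₃ x n))
      , (λ x → lift (λ n → ≈trans (on-B₃ x n) (lower (sq₃₁ ψ x) n)))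
      , (λ x → lift (λ b → ≈trans (on-B₃ x (π*⁻¹ b)) (lower (sq₃₂ ψ x) b)))
      where
      weight≈ : ∀ a → weight (predualMorphism ψ) a ≈ reflected-coweight ψ a
      weight≈ = SupportedOnS.dot-S-δ (reflected-coweight ψ)
                  (reflected-coweight-vanishes₁ ψ) (reflected-coweight-vanishes₂ ψ)
      on-B₃ : ∀ x n → lower x *ₖ weight (predualMorphism ψ) (L₁ - n) ≈ coeff (fun (φB₃ ψ) x) n
      on-B₃ x n = ≈trans (*-cong ≈refl (≈trans (weight≈ (L₁ - n)) (≈reflexive (cong (coweight ψ) (sub-sub L₁ n)))))
                         (≈sym (coeff-from-1 (φB₃ ψ) x n))

    predual∘dual : ∀ φ → Space._≋_ (HomSpace Md kDiag/B₁B₂) (predualMorphism (dualMorphism φ)) φ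
    predual∘dual φ = (λ _ → tt) , (λ _ → tt) , (λ x → lift (on-B₃ x))
                   , (λ x → lift (≈trans (on-B₃ x) (lower (sq₃₁ φ x)))) , (λ y → lift (on-A₂ y))
      where
      w = reflected-coweight (dualMorphism φ)
      w≈weight : ∀ a → w a ≈ weight φ a
      w≈weight a = ≈trans (*-identityˡ _) (≈reflexive (cong (weight φ) (sub-sub L₁ a)))
      on-B₃ : ∀ x → dot S (λ a → coeff x a) w ≈ eval (φB₃ φ) x
      on-B₃ = kℤ-functional-ext (dotMap S (λ a → a) w) (φB₃ φ) (λ m → ≈trans
        (SupportedOnS.dot-S-δ w (λ a h → ≈trans (w≈weight a) (weight-vanishes₁ φ a h))
                                (λ a h → ≈trans (w≈weight a) (weight-vanishes₂ φ a h)) m)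
        (w≈weight m))
      π⁻¹-bij : Bij
      π⁻¹-bij = record { π = π⁻¹ ; π⁻¹ = π ; π∘π⁻¹ = π⁻¹∘π ; π⁻¹∘π = π∘π⁻¹ }
      on-A₂ : ∀ y → dot S (λ a → coeff y (π a)) w ≈ eval (φA₂ φ) y
      on-A₂ y = ≈trans (on-B₃ x) (≈trans (lower (sq₃₂ φ x))
        (lower (LinMap.resp (φA₂ φ) {fun (reindex bij) x} {y} (lift (λ b → ≈reflexive (cong (coeff y) (π∘π⁻¹ b)))))))
        where x = fun (reindex π⁻¹-bij) y

    Hom-k/B₁B₂≅Hom-k-dual : LinIso (HomSpace Md kDiag/B₁B₂) (HomSpace kDiag M*d)
    Hom-k/B₁B₂≅Hom-k-dual = record
      { to = toDualMorphism ; from = toPredualMorphism ; to∘from = dual∘predual ; from∘to = predual∘dual }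

    sel-reflect : ∀ c t a → c *ₖ sel (a ≟ L₁ - t) 1# ≈ sel (t ≟ L₁ - a) c
    sel-reflect c t a with a ≟ L₁ - t | t ≟ L₁ - a
    ... | yes _  | yes _  = *-identityʳ c
    ... | no _   | no _   = zeroʳ c
    ... | yes e  | no ne = ⊥-elim (ne (trans (sym (sub-sub L₁ t)) (cong reflect (sym e))))
    ... | no ne | yes e  = ⊥-elim (ne (trans (sym (sub-sub L₁ a)) (cong reflect (sym e))))

    ε↦η : ∀ a₁ (h₁ : d₁ + 1ℤ ≤ a₁) (h₂ : d₂ + 1ℤ ≤ π a₁) →
          Space._≋_ (HomSpace kDiag M*d) (dualMorphism (ε P (d₁ , d₂) a₁ h₁ h₂))
                                         (η P (K₁ , K₂) (d₁ , d₂) a₁ h₁ h₂)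
    ε↦η a₁ h₁ h₂ =
        (λ x → lift (λ n → sel-reflect (lower x) n a₁))
      , (λ x → lift (λ b → on-A₂ (lower x) b))
      , (λ x → lift (λ n → sel-reflect (lower x) n a₁))
      , (λ x → lift (λ n → sel-reflect (lower x) n a₁))
      , (λ x → lift (λ b → on-A₂ (lower x) b))
      where
      on-A₂ : ∀ c b → c *ₖ sel (a₁ ≟ L₁ - π*⁻¹ b) 1# ≈ sel (b ≟ π* (L₁ - a₁)) c
      on-A₂ c b = ≈trans (sel-reflect c (π*⁻¹ b) a₁) (sel-π β* (L₁ - a₁) b c)

    module H* = Matching P* q₁ q₂

    b₁ b₂ b₃ : Ker∂ Md → Carrier kℤ
    b₁ k = fun (incl d₁) (Ker∂.b₁ k)
    b₂ k = fun (incl d₂) (Ker∂.b₂ k)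
    b₃ k = Ker∂.b₃ k

    ∂≡0₁ : ∀ k n → coeff (b₁ k) n ≈ coeff (b₃ k) n
    ∂≡0₁ k = lower (Ker∂.∂b≡0₁ k)

    ∂≡0₂ : ∀ k n → coeff (b₂ k) n ≈ coeff (b₃ k) (π⁻¹ n)
    ∂≡0₂ k = lower (Ker∂.∂b≡0₂ k)

    ∂≡0₂′ : ∀ k a → coeff (b₂ k) (π a) ≈ coeff (b₃ k) a
    ∂≡0₂′ k a = ≈trans (∂≡0₂ k (π a)) (≈reflexive (cong (coeff (b₃ k)) (π⁻¹∘π a)))

    cocycle-vanishes₁ : ∀ k a → ¬ (a ≤ d₁) → coeff (b₃ k) a ≈ 0#
    cocycle-vanishes₁ k a a≰d₁ = ≈trans (≈sym (∂≡0₁ k a)) (outside (Ker∂.b₁ k) a a≰d₁)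

    cocycle-vanishes₂ : ∀ k a → ¬ (π a ≤ d₂) → coeff (b₃ k) a ≈ 0#
    cocycle-vanishes₂ k a πa≰d₂ = ≈trans (≈sym (∂≡0₂′ k a)) (outside (Ker∂.b₂ k) (π a) πa≰d₂)

    H⁰-basis : ∀ a → a ≤ d₁ → π a ≤ d₂ → Ker∂ Md
    H⁰-basis a a≤d₁ πa≤d₂ = record
      { b₁ = single (_≤ d₁) a a≤d₁ 1# ; b₂ = single (_≤ d₂) (π a) πa≤d₂ 1# ; b₃ = 𝐞 a
      ; ∂b≡0₁ = lift (λ _ → ≈refl) ; ∂b≡0₂ = lift (λ n → ≈sym (sel-π bij a n 1#)) }

    _·ᴴ_ : K → Ker∂ Md → Ker∂ Md
    s ·ᴴ k = record
      { b₁ = s ·ᵛ Ker∂.b₁ k ; b₂ = s ·ᵛ Ker∂.b₂ k ; b₃ = s ·ᵛ Ker∂.b₃ k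
      ; ∂b≡0₁ = lift (λ n → *-cong ≈refl (∂≡0₁ k n)) ; ∂b≡0₂ = lift (λ n → *-cong ≈refl (∂≡0₂ k n)) }

    eraseᴴ : ℤ → Ker∂ Md → Ker∂ Md
    eraseᴴ m k = record
      { b₁ = erase m (Ker∂.b₁ k) ; b₂ = erase (π m) (Ker∂.b₂ k) ; b₃ = erase m (Ker∂.b₃ k)
      ; ∂b≡0₁ = lift on-A₁ ; ∂b≡0₂ = lift on-A₂ }
      where
      on-A₁ : ∀ n → selᶜ (n ≟ m) (coeff (b₁ k) n) ≈ selᶜ (n ≟ m) (coeff (b₃ k) n)
      on-A₁ n with n ≟ m
      ... | yes _ = ≈refl
      ... | no _  = ∂≡0₁ k n
      on-A₂ : ∀ n → selᶜ (n ≟ π m) (coeff (b₂ k) n) ≈ selᶜ (π⁻¹ n ≟ m) (coeff (b₃ k) (π⁻¹ n))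
      on-A₂ n with n ≟ π m | π⁻¹ n ≟ m
      ... | yes _  | yes _  = ≈refl
      ... | no _   | no _   = ∂≡0₂ k n
      ... | yes e  | no ne = ⊥-elim (ne (dual-π-inv′ bij e))
      ... | no ne | yes e  = ⊥-elim (ne (dual-π-inv bij e))

    H⁰-eval-0 : ∀ (f : LinMap (H⁰ Md) kSpace) k → (∀ n → coeff (b₃ k) n ≈ 0#) → eval f k ≈ 0#
    H⁰-eval-0 f k b₃≈0 =
      ≈trans (lower (LinMap.homogeneous f {0#} {k} {k}
                      (0·x≈x (Ker∂.b₁ k) b₁≈0 , 0·x≈x (Ker∂.b₂ k) b₂≈0 , 0·x≈x (b₃ k) b₃≈0)))
             (zeroˡ _)
      where
      0·x≈x : ∀ {P} (x : FinSupp P) → (∀ n → coeff x n ≈ 0#) → Space.Scale (kSum P) 0# x x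
      0·x≈x x x≈0 = lift (λ n → ≈trans (x≈0 n) (≈sym (*≈0ʳ (x≈0 n))))
      b₁≈0 : ∀ n → coeff (b₁ k) n ≈ 0#
      b₁≈0 n = ≈trans (∂≡0₁ k n) (b₃≈0 n)
      b₂≈0 : ∀ n → coeff (b₂ k) n ≈ 0#
      b₂≈0 n = ≈trans (∂≡0₂ k n) (b₃≈0 (π⁻¹ n))

    erase-≋ : ∀ m k → coeff (b₃ k) m ≈ 0# → Space._≋_ (H⁰ Md) k (eraseᴴ m k)
    erase-≋ m k kₘ≈0 = lift (unchanged (b₁ k) m (≈trans (∂≡0₁ k m) kₘ≈0))
                     , lift (unchanged (b₂ k) (π m) (≈trans (∂≡0₂′ k m) kₘ≈0))
                     , lift (unchanged (b₃ k) m kₘ≈0)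
      where
      unchanged : ∀ (x : Carrier kℤ) i → coeff x i ≈ 0# → ∀ n → coeff x n ≈ selᶜ (n ≟ i) (coeff x n)
      unchanged x i xᵢ≈0 n with n ≟ i
      ... | yes refl = xᵢ≈0
      ... | no _     = ≈refl

    agree-via-≋ : ∀ {V} (f g : LinMap V kSpace) {x x′} → Space._≋_ V x x′ →
                  eval f x′ ≈ eval g x′ → eval f x ≈ eval g x
    agree-via-≋ f g x≋x′ f≈g = ≈trans (lower (LinMap.resp f x≋x′)) (≈trans f≈g (≈sym (lower (LinMap.resp g x≋x′))))

    -- k = k_m · basis m + eraseᴴ m k, where k_m = 0 unless m ≤ d₁ and π m ≤ d₂.
    H⁰-split-off : (f g : LinMap (H⁰ Md) kSpace) →
                   (∀ a h₁ h₂ → eval f (H⁰-basis a h₁ h₂) ≈ eval g (H⁰-basis a h₁ h₂)) →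
                   ∀ m k → eval f (eraseᴴ m k) ≈ eval g (eraseᴴ m k) → eval f k ≈ eval g k
    H⁰-split-off f g f≈g m k ih with m ≤? d₁ | π m ≤? d₂
    ... | yes h₁ | yes h₂ = begin
        eval f k                                            ≈⟨ lower (LinMap.additive f split) ⟩
        eval f (kₘ ·ᴴ basis) +ₖ eval f (eraseᴴ m k)         ≈⟨ +-cong (lower (LinMap.homogeneous f scale)) ih ⟩
        kₘ *ₖ eval f basis +ₖ eval g (eraseᴴ m k)           ≈⟨ +-cong (*-cong ≈refl (f≈g m h₁ h₂)) ≈refl ⟩
        kₘ *ₖ eval g basis +ₖ eval g (eraseᴴ m k)           ≈⟨ +-cong (lower (LinMap.homogeneous g scale)) ≈refl ⟨
        eval g (kₘ ·ᴴ basis) +ₖ eval g (eraseᴴ m k)         ≈⟨ lower (LinMap.additive g split) ⟨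
        eval g k                                            ∎
      where
      basis = H⁰-basis m h₁ h₂
      kₘ = coeff (b₃ k) m
      split-at : ∀ (x : Carrier kℤ) i → coeff x i ≈ kₘ → ∀ n →
                 coeff x n ≈ kₘ *ₖ sel (n ≟ i) 1# +ₖ selᶜ (n ≟ i) (coeff x n)
      split-at x i xᵢ≈kₘ n = ≈trans (sel+selᶜ (coeff x) i n) (+-cong (*-cong xᵢ≈kₘ ≈refl) ≈refl)
      split : Space.Sum (H⁰ Md) (kₘ ·ᴴ basis) (eraseᴴ m k) k
      split = lift (split-at (b₁ k) m (∂≡0₁ k m)) , lift (split-at (b₂ k) (π m) (∂≡0₂′ k m))
            , lift (split-at (b₃ k) m ≈refl)
      scale : Space.Scale (H⁰ Md) kₘ basis (kₘ ·ᴴ basis)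
      scale = lift (λ _ → ≈refl) , lift (λ _ → ≈refl) , lift (λ _ → ≈refl)
    ... | no m≰d₁ | _        = agree-via-≋ f g (erase-≋ m k (cocycle-vanishes₁ k m m≰d₁)) ih
    ... | yes _   | no πm≰d₂ = agree-via-≋ f g (erase-≋ m k (cocycle-vanishes₂ k m πm≰d₂)) ih

    H⁰-functional-ext : (f g : LinMap (H⁰ Md) kSpace) →
                        (∀ a h₁ h₂ → eval f (H⁰-basis a h₁ h₂) ≈ eval g (H⁰-basis a h₁ h₂)) →
                        ∀ k → eval f k ≈ eval g k
    H⁰-functional-ext f g f≈g k = go (support (b₃ k)) k (vanish (b₃ k))
      where
      go : ∀ l k → (∀ n → n ∉ l → coeff (b₃ k) n ≈ 0#) → eval f k ≈ eval g k
      go []      k b₃≈0 = ≈trans (H⁰-eval-0 f k (λ n → b₃≈0 n (λ ())))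
                                 (≈sym (H⁰-eval-0 g k (λ n → b₃≈0 n (λ ()))))
      go (m ∷ l) k b₃≈0 = H⁰-split-off f g f≈g m k (go l (eraseᴴ m k) erased≈0)
        where
        erased≈0 : ∀ n → n ∉ l → selᶜ (n ≟ m) (coeff (b₃ k) n) ≈ 0#
        erased≈0 n n∉ with n ≟ m
        ... | yes _ = ≈refl
        ... | no ne = b₃≈0 n (λ { (here e) → ne e ; (there n∈) → n∉ n∈ })

    functionalWeight′ : LinMap (H⁰ Md) kSpace → ∀ a → Dec (a ≤ d₁) → Dec (π a ≤ d₂) → K
    functionalWeight′ g a (yes h₁) (yes h₂) = eval g (H⁰-basis a h₁ h₂)
    functionalWeight′ g a _        _        = 0#

    functionalWeight : LinMap (H⁰ Md) kSpace → ℤ → K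
    functionalWeight g a = functionalWeight′ g a (a ≤? d₁) (π a ≤? d₂)

    functionalWeight-basis : ∀ g a h₁ h₂ → functionalWeight g a ≈ eval g (H⁰-basis a h₁ h₂)
    functionalWeight-basis g a h₁ h₂ with a ≤? d₁ | π a ≤? d₂
    ... | yes _   | yes _   = lower (LinMap.resp g (lift (λ _ → ≈refl) , lift (λ _ → ≈refl) , lift (λ _ → ≈refl)))
    ... | no a≰d₁ | _       = ⊥-elim (a≰d₁ h₁)
    ... | yes _   | no πa≰d₂ = ⊥-elim (πa≰d₂ h₂)

    functionalWeight-vanishes₂ : ∀ g a → ¬ (π a ≤ d₂) → functionalWeight g a ≈ 0#
    functionalWeight-vanishes₂ g a πa≰d₂ with a ≤? d₁ | π a ≤? d₂
    ... | yes _ | yes πa≤d₂ = ⊥-elim (πa≰d₂ πa≤d₂)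
    ... | yes _ | no _      = ≈refl
    ... | no _  | _         = ≈refl

    functionalWeight-off-T : ∀ g a → a ∉ T → functionalWeight g a ≈ 0#
    functionalWeight-off-T g a a∉ with a ≤? d₁ | π a ≤? d₂
    ... | yes a≤d₁ | yes πa≤d₂ = ⊥-elim (a∉ (∈T a≤d₁ πa≤d₂))
    ... | yes _    | no _      = ≈refl
    ... | no _     | _         = ≈refl

    functionalWeight-rel : ∀ (R : K → K → K → Set ℓ) → R 0# 0# 0# → ∀ g g′ g″ →
                           (∀ k → R (eval g k) (eval g′ k) (eval g″ k)) →
                           ∀ a → R (functionalWeight g a) (functionalWeight g′ a) (functionalWeight g″ a)
    functionalWeight-rel R r₀ g g′ g″ r a with a ≤? d₁ | π a ≤? d₂
    ... | yes h₁ | yes h₂ = r (H⁰-basis a h₁ h₂)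
    ... | yes _  | no _   = r₀
    ... | no _   | _      = r₀

    reflectedFunctionalWeight : LinMap (H⁰ Md) kSpace → Carrier kℤ
    reflectedFunctionalWeight g = record
      { coeff   = λ n → functionalWeight g (L₁ - n)
      ; support = map reflect T
      ; vanish  = λ n n∉ → functionalWeight-off-T g (L₁ - n)
                    (λ m → n∉ (subst (_∈ map reflect T) (sub-sub L₁ n) (∈-map⁺ reflect m)))
      ; outside = λ _ ¬tt → ⊥-elim (¬tt tt) }

    toH¹ : LinMap (Dual (H⁰ Md)) (H¹ M*d)
    toH¹ = record
      { fun         = λ g → (reflectedFunctionalWeight g , 0ᵛ)
      ; resp        = λ {g} {g′} E → H*.H¹-≋-pointwise (reflectedFunctionalWeight g) 0ᵛ (reflectedFunctionalWeight g′) 0ᵛ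
          (λ n → functionalWeight-rel (λ x y _ → x ≈ y) ≈refl g g′ g′ (λ k → lower (E k)) (L₁ - n)) (λ _ → ≈refl)
      ; additive    = λ {g} {g′} {g″} E → H*.H¹-Sum-pointwise
          (reflectedFunctionalWeight g) 0ᵛ (reflectedFunctionalWeight g′) 0ᵛ (reflectedFunctionalWeight g″) 0ᵛ
          (λ n → functionalWeight-rel (λ x y z → z ≈ x +ₖ y) (≈sym 0+0≈0) g g′ g″ (λ k → lower (E k)) (L₁ - n))
          (λ _ → ≈sym 0+0≈0)
      ; homogeneous = λ {s} {g} {g″} E → H*.H¹-Scale-pointwise
          (reflectedFunctionalWeight g) 0ᵛ (reflectedFunctionalWeight g″) 0ᵛ
          (λ n → functionalWeight-rel (λ x _ z → z ≈ s *ₖ x) (≈sym (zeroʳ s)) g g g″ (λ k → lower (E k)) (L₁ - n))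
          (λ _ → ≈sym (zeroʳ s)) }

    classWeight : Carrier (H¹ M*d) → ℤ → K
    classWeight (x₁ , x₂) a = coeff x₁ (L₁ - a) -ₖ coeff x₂ (π* (L₁ - a))

    -- On T, classWeight only depends on the class: coboundaries contribute nothing there.
    classWeight-resp : ∀ {x y} → Space._≋_ (H¹ M*d) x y →
                       ∀ a → a ≤ d₁ → π a ≤ d₂ → classWeight x a ≈ classWeight y a
    classWeight-resp {x₁ , x₂} {y₁ , y₂} (c₁ , c₂ , c₃ , u₁ , u₂ , lift s₁ , lift s₂ , lift s₃ , lift s₄)
                     a a≤d₁ πa≤d₂ = begin
        X₁ n -ₖ X₂ m                               ≈⟨ [x+t]-[y+t]≈x-y _ _ _ ⟨
        (X₁ n +ₖ C₃ n) -ₖ (X₂ m +ₖ C₃ n)           ≈⟨ −-cong (≈sym (s₁ n)) (+-cong ≈refl C₃-n) ⟩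
        coeff u₁ n -ₖ (X₂ m +ₖ C₃ (π*⁻¹ m))        ≈⟨ −-cong (s₂ n) (≈sym (s₃ m)) ⟩
        (Y₁ n +ₖ coeff c₁ n) -ₖ coeff u₂ m         ≈⟨ −-cong (+-cong ≈refl c₁-n) (s₄ m) ⟩
        (Y₁ n +ₖ 0#) -ₖ (Y₂ m +ₖ coeff c₂ m)       ≈⟨ −-cong (+-identityʳ _) (≈trans (+-cong ≈refl c₂-m) (+-identityʳ _)) ⟩
        Y₁ n -ₖ Y₂ m                               ∎
      where
      n = L₁ - a
      m = π* n
      X₁ = coeff x₁ ; X₂ = coeff x₂ ; Y₁ = coeff y₁ ; Y₂ = coeff y₂ ; C₃ = coeff c₃
      C₃-n : C₃ n ≈ C₃ (π*⁻¹ m)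
      C₃-n = ≈reflexive (cong C₃ (sym (Bij.π⁻¹∘π β* n)))
      c₁-n : coeff c₁ n ≈ 0#
      c₁-n = outside c₁ n (≤⇒reflected-≰ K₁ d₁ a a≤d₁)
      c₂-m : coeff c₂ m ≈ 0#
      c₂-m = outside c₂ m (λ h → ≤⇒reflected-≰ K₂ d₂ (π a) πa≤d₂ (subst (_≤ q₂) (π*-reflect a) h))

    classFunctional : Carrier (H¹ M*d) → LinMap (H⁰ Md) kSpace
    classFunctional x = record
      { fun         = λ k → lift (dot T (coeff (b₃ k)) (classWeight x))
      ; resp        = λ (_ , _ , lift e₃) → lift (dot-cong T (λ a _ → *-cong (e₃ a) ≈refl))
      ; additive    = λ (_ , _ , lift e₃) → lift (dot-+ˡ T e₃)
      ; homogeneous = λ (_ , _ , lift e₃) → lift (dot-*ˡ T e₃) }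

    classFunctional-resp : ∀ {x y} → Space._≋_ (H¹ M*d) x y → ∀ k → eval (classFunctional x) k ≈ eval (classFunctional y) k
    classFunctional-resp {x} {y} x≋y k = dot-cong T (λ a _ → term a)
      where
      term : ∀ a → coeff (b₃ k) a *ₖ classWeight x a ≈ coeff (b₃ k) a *ₖ classWeight y a
      term a with a ≤? d₁ | π a ≤? d₂
      ... | yes a≤d₁ | yes πa≤d₂ = *-cong ≈refl (classWeight-resp {x} {y} x≋y a a≤d₁ πa≤d₂)
      ... | no a≰d₁  | _         = 0*x≈0*y (cocycle-vanishes₁ k a a≰d₁)
      ... | yes _    | no πa≰d₂  = 0*x≈0*y (cocycle-vanishes₂ k a πa≰d₂)

    fromH¹ : LinMap (H¹ M*d) (Dual (H⁰ Md))
    fromH¹ = record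
      { fun         = classFunctional
      ; resp        = λ {x} {y} x≋y k → lift (classFunctional-resp {x} {y} x≋y k)
      ; additive    = λ {x} {y} {z} (w₁ , w₂ , lift S₁ , lift S₂ , w≋z) k →
          lift (≈trans (≈sym (classFunctional-resp {w₁ , w₂} {z} w≋z k))
                 (dot-+ʳ T (λ a → ≈trans (−-cong (S₁ (L₁ - a)) (S₂ (π* (L₁ - a)))) ([a+b]-[c+d]≈[a-c]+[b-d] _ _ _ _))))
      ; homogeneous = λ {s} {x} {z} (w₁ , w₂ , lift S₁ , lift S₂ , w≋z) k →
          lift (≈trans (≈sym (classFunctional-resp {w₁ , w₂} {z} w≋z k))
                 (dot-*ʳ T (λ a → ≈trans (−-cong (S₁ (L₁ - a)) (S₂ (π* (L₁ - a)))) (*-distribˡ-− _ _ _)))) }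

    classFunctional-basis : ∀ x a h₁ h₂ → eval (classFunctional x) (H⁰-basis a h₁ h₂) ≈ classWeight x a
    classFunctional-basis x a h₁ h₂ = ≈trans (dot-δ-interval _ _ a (∈T h₁ h₂)) (*-identityˡ _)

    fromH¹∘toH¹ : ∀ g → Space._≋_ (Dual (H⁰ Md)) (classFunctional (reflectedFunctionalWeight g , 0ᵛ)) g
    fromH¹∘toH¹ g k = lift (H⁰-functional-ext (classFunctional (reflectedFunctionalWeight g , 0ᵛ)) g
      (λ a h₁ h₂ → ≈trans (classFunctional-basis (reflectedFunctionalWeight g , 0ᵛ) a h₁ h₂)
                     (≈trans (≈trans (x-0≈x _) (≈reflexive (cong (functionalWeight g) (sub-sub L₁ a))))
                             (functionalWeight-basis g a h₁ h₂))) k)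

    -- Every class of H¹(M*) has a representative (y , 0) with y = reflectedFunctionalWeight of
    -- its functional.  In the coboundary c exhibiting this, c₃ agrees with x₁ where π* n ≤ q₂ and
    -- with x₂ ∘ π* elsewhere; c₁ and c₂ absorb what is left, which vanishes outside their ranges.
    module Representative (x : Carrier (H¹ M*d)) where
      x₁ x₂ y : Carrier kℤ
      x₁ = proj₁ x
      x₂ = proj₂ x
      y  = reflectedFunctionalWeight (classFunctional x)

      X₁ X₂ Y : ℤ → K
      X₁ = coeff x₁
      X₂ = coeff x₂
      Y  = coeff y

      Y-on-T : ∀ n → L₁ - n ≤ d₁ → π (L₁ - n) ≤ d₂ → Y n ≈ X₁ n -ₖ X₂ (π* n)
      Y-on-T n h₁ h₂ = begin
          Y n                                          ≈⟨ functionalWeight-basis (classFunctional x) a h₁ h₂ ⟩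
          eval (classFunctional x) (H⁰-basis a h₁ h₂)  ≈⟨ classFunctional-basis x a h₁ h₂ ⟩
          X₁ (L₁ - a) -ₖ X₂ (π* (L₁ - a))              ≡⟨ cong (λ t → X₁ t -ₖ X₂ (π* t)) (sub-sub L₁ n) ⟩
          X₁ n -ₖ X₂ (π* n)                            ∎
        where a = L₁ - n

      c₃′ : ∀ n → Dec (π* n ≤ q₂) → K
      c₃′ n (yes _) = X₁ n
      c₃′ n (no _)  = X₂ (π* n)

      C₃ : ℤ → K
      C₃ n = c₃′ n (π* n ≤? q₂)

      C₃-yes : ∀ n → π* n ≤ q₂ → C₃ n ≈ X₁ n
      C₃-yes n h with π* n ≤? q₂
      ... | yes _ = ≈refl
      ... | no ¬h = ⊥-elim (¬h h)

      C₃-no : ∀ n → ¬ (π* n ≤ q₂) → C₃ n ≈ X₂ (π* n)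
      C₃-no n ¬h with π* n ≤? q₂
      ... | yes h = ⊥-elim (¬h h)
      ... | no _  = ≈refl

      c₃ : Carrier kℤ
      c₃ = record
        { coeff   = C₃
        ; support = support x₁ ++ map π*⁻¹ (support x₂)
        ; vanish  = van
        ; outside = λ _ ¬tt → ⊥-elim (¬tt tt) }
        where
        van : ∀ n → n ∉ support x₁ ++ map π*⁻¹ (support x₂) → C₃ n ≈ 0#
        van n n∉ with π* n ≤? q₂
        ... | yes _ = vanish x₁ n (∉-++⁻ˡ n∉)
        ... | no _  = vanish x₂ (π* n) (λ m → ∉-++⁻ʳ (support x₁) n∉
                        (subst (_∈ map π*⁻¹ (support x₂)) (Bij.π⁻¹∘π β* n) (∈-map⁺ π*⁻¹ m)))

      c₂′ : ∀ b → Dec (b ≤ q₂) → K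
      c₂′ b (yes _) = C₃ (π*⁻¹ b) -ₖ X₂ b
      c₂′ b (no _)  = 0#

      c₂ : FinSupp (_≤ q₂)
      c₂ = record
        { coeff   = λ b → c₂′ b (b ≤? q₂)
        ; support = map π* (support c₃) ++ support x₂
        ; vanish  = van
        ; outside = out }
        where
        van : ∀ b → b ∉ map π* (support c₃) ++ support x₂ → c₂′ b (b ≤? q₂) ≈ 0#
        van b b∉ with b ≤? q₂
        ... | no _  = ≈refl
        ... | yes _ = ≈trans (−-cong
                (vanish c₃ (π*⁻¹ b) (λ m → ∉-++⁻ˡ b∉
                  (subst (_∈ map π* (support c₃)) (Bij.π∘π⁻¹ β* b) (∈-map⁺ π* m))))
                (vanish x₂ b (∉-++⁻ʳ (map π* (support c₃)) b∉))) (-‿inverseʳ 0#)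
        out : ∀ b → ¬ (b ≤ q₂) → c₂′ b (b ≤? q₂) ≈ 0#
        out b b≰q₂ with b ≤? q₂
        ... | yes b≤q₂ = ⊥-elim (b≰q₂ b≤q₂)
        ... | no _     = ≈refl

      c₁′ : ∀ n → Dec (n ≤ q₁) → K
      c₁′ n (yes _) = (Y n +ₖ C₃ n) -ₖ X₁ n
      c₁′ n (no _)  = 0#

      c₁ : FinSupp (_≤ q₁)
      c₁ = record
        { coeff   = λ n → c₁′ n (n ≤? q₁)
        ; support = support y ++ (support c₃ ++ support x₁)
        ; vanish  = van
        ; outside = out }
        where
        van : ∀ n → n ∉ support y ++ (support c₃ ++ support x₁) → c₁′ n (n ≤? q₁) ≈ 0#
        van n n∉ with n ≤? q₁
        ... | no _  = ≈refl
        ... | yes _ = ≈trans (−-cong (≈trans (+-cong (vanish y n (∉-++⁻ˡ n∉))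
                                                      (vanish c₃ n (∉-++⁻ˡ (∉-++⁻ʳ (support y) n∉)))) 0+0≈0)
                                     (vanish x₁ n (∉-++⁻ʳ (support c₃) (∉-++⁻ʳ (support y) n∉))))
                             (-‿inverseʳ 0#)
        out : ∀ n → ¬ (n ≤ q₁) → c₁′ n (n ≤? q₁) ≈ 0#
        out n n≰q₁ with n ≤? q₁
        ... | yes n≤q₁ = ⊥-elim (n≰q₁ n≤q₁)
        ... | no _     = ≈refl

      A₁-balance-off-q₁ : ∀ n → L₁ - n ≤ d₁ → Dec (π* n ≤ q₂) → Y n +ₖ C₃ n ≈ X₁ n +ₖ 0#
      A₁-balance-off-q₁ n h₁ (yes π*n≤q₂) = begin
          Y n +ₖ C₃ n      ≈⟨ +-cong (functionalWeight-vanishes₂ (classFunctional x) (L₁ - n)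
                                       (+1≤⇒≰ (bound-lem⁻¹ K₂ d₂ (π (L₁ - n)) π*n≤q₂)))
                                     (C₃-yes n π*n≤q₂) ⟩
          0# +ₖ X₁ n       ≈⟨ +-comm 0# (X₁ n) ⟩
          X₁ n +ₖ 0#       ∎
      A₁-balance-off-q₁ n h₁ (no π*n≰q₂) = begin
          Y n +ₖ C₃ n                            ≈⟨ +-cong (Y-on-T n h₁ (reflected-≰⇒≤ K₂ d₂ (π (L₁ - n)) π*n≰q₂))
                                                           (C₃-no n π*n≰q₂) ⟩
          (X₁ n -ₖ X₂ (π* n)) +ₖ X₂ (π* n)       ≈⟨ [x-y]+y≈x (X₁ n) (X₂ (π* n)) ⟩
          X₁ n                                   ≈⟨ +-identityʳ (X₁ n) ⟨
          X₁ n +ₖ 0#                             ∎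

      A₁-balance : ∀ n (d : Dec (n ≤ q₁)) → Y n +ₖ C₃ n ≈ X₁ n +ₖ c₁′ n d
      A₁-balance n (yes _)    = ≈sym (x+[y-x]≈y (X₁ n) (Y n +ₖ C₃ n))
      A₁-balance n (no n≰q₁) = A₁-balance-off-q₁ n
        (reflected-≰⇒≤ K₁ d₁ (L₁ - n) (λ h → n≰q₁ (subst (_≤ q₁) (sub-sub L₁ n) h))) (π* n ≤? q₂)

      A₂-balance : ∀ b (d : Dec (b ≤ q₂)) → C₃ (π*⁻¹ b) ≈ X₂ b +ₖ c₂′ b d
      A₂-balance b (yes _)    = ≈sym (x+[y-x]≈y (X₂ b) (C₃ (π*⁻¹ b)))
      A₂-balance b (no b≰q₂) = begin
          C₃ (π*⁻¹ b)          ≈⟨ C₃-no (π*⁻¹ b) (λ h → b≰q₂ (subst (_≤ q₂) (Bij.π∘π⁻¹ β* b) h)) ⟩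
          X₂ (π* (π*⁻¹ b))     ≡⟨ cong X₂ (Bij.π∘π⁻¹ β* b) ⟩
          X₂ b                 ≈⟨ +-identityʳ (X₂ b) ⟨
          X₂ b +ₖ 0#           ∎

      represents : Space._≋_ (H¹ M*d) (y , 0ᵛ) x
      represents = c₁ , c₂ , c₃ , y +ᵛ c₃ , fun (reindex β*) c₃
                 , lift (λ _ → ≈refl)
                 , lift (λ n → A₁-balance n (n ≤? q₁))
                 , lift (λ b → ≈sym (+-identityˡ (C₃ (π*⁻¹ b))))
                 , lift (λ b → A₂-balance b (b ≤? q₂))

    Dual-H⁰≅H¹-dual : LinIso (Dual (H⁰ Md)) (H¹ M*d)
    Dual-H⁰≅H¹-dual = record
      { to = toH¹ ; from = fromH¹ ; to∘from = Representative.represents ; from∘to = fromH¹∘toH¹ }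

    Dual-H¹≅Hom-k-dual : LinIso (Dual (H¹ Md)) (HomSpace kDiag M*d)
    Dual-H¹≅Hom-k-dual = LinIso-trans (Matching.Dual-H¹≅Hom-k/B₁B₂ P d₁ d₂) Hom-k/B₁B₂≅Hom-k-dual
                           (Dual-≋-trans (H¹ Md)) (H*.Hom-≋-trans kDiag)

    Dual-H¹≅H⁰-dual : LinIso (Dual (H¹ Md)) (H⁰ M*d)
    Dual-H¹≅H⁰-dual = LinIso-trans Dual-H¹≅Hom-k-dual H*.Hom-k≅H⁰ (Dual-≋-trans (H¹ Md)) H*.H⁰-≋-trans

theorem9p2 : ∀ {c ℓ : Level} (k : Field c ℓ) (W : PerfectMatching) (K d : ℤ × ℤ) →
    let open Over k
        L = K +² one²
        W* = dualPM L W
        Md = M W d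
        M*d = M W* (K -² d)
    in Σ (LinIso (HomSpace Md kDiag/B₁B₂) (HomSpace kDiag M*d)) (λ Φ →
         ∀ (a₁ : ℤ) (h₁ : proj₁ d + 1ℤ ≤ a₁) (h₂ : proj₂ d + 1ℤ ≤ PerfectMatching.π W a₁) →
           Space._≋_ (HomSpace kDiag M*d)
             (LinMap.fun (LinIso.to Φ) (ε W d a₁ h₁ h₂))
             (η W K d a₁ h₁ h₂))
     × LinIso (Dual (H¹ Md)) (HomSpace kDiag M*d)
     × LinIso (Dual (H⁰ Md)) (H¹ M*d)
     × LinIso (Dual (H¹ Md)) (H⁰ M*d)
theorem9p2 k W (K₁ , K₂) (d₁ , d₂) =
  (Hom-k/B₁B₂≅Hom-k-dual , ε↦η) , Dual-H¹≅Hom-k-dual , Dual-H⁰≅H¹-dual , Dual-H¹≅H⁰-dual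
  where open Linear.Duality k W K₁ K₂ d₁ d₂
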